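{- Let $k\ge 0$ be an integer. There is a polynomial $P_k$ in $n$ of degree exactly $k$ with leading coefficient $\frac{3^k}{k!}$ such that $r_{2n-k}(n)=P_k(n)$ for all sufficiently large integers $n$.
   Context: For integers $n\ge 1$ and $j$, let $r_j(n)$ denote the number of ways to divide a $2\times n$ rectangular strip of $2n$ unit squares (2 rows, $n$ columns) into exactly $j$ pieces by cutting only along edges of the unit squares, each piece being an edge-connected union of unit squares (equivalently, partitions of the vertex set of the ladder graph $P_2\times P_n$ into $j$ blocks each inducing a connected subgraph); $r_j(n)=0$ for $j\le 0$ or $j>2n$. -}

module Defs where

open import Data.Nat as ℕ using (ℕ; zero; suc; _∸_; _^_; _!; _≥_)
open import Data.Nat.Properties using (_!≢0)
open import Data.Fin using (Fin; toℕ)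
open import Data.Bool using (Bool; true)
open import Data.Vec using (Vec; lookup; []; _∷_)
open import Data.List using (List; length)
open import Data.List.Membership.Propositional using (_∈_)
open import Data.List.Relation.Unary.Unique.Propositional using (Unique)
open import Data.Product using (Σ; ∃; _×_; _,_)
open import Data.Sum using (_⊎_)
open import Data.Integer using (+_)
open import Data.Rational as ℚ using (ℚ; _/_)
open import Relation.Nullary using (¬_)
open import Function.Bundles using (_⇔_)
open import Relation.Binary.PropositionalEquality using (_≡_)

IsCount : ∀ {A : Set} → (A → Set) → ℕ → Set
IsCount {A} P m = Σ (List A) λ L → Unique L × (∀ x → (x ∈ L) ⇔ P x) × length L ≡ m

-- The ladder graph P₂ × Pₙ : vertices (row , column), row ∈ Fin 2, column ∈ Fin n.

Vertex : ℕ → Set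
Vertex n = Fin 2 × Fin n

Consec : ∀ {n} → Fin n → Fin n → Set
Consec i j = suc (toℕ i) ≡ toℕ j ⊎ suc (toℕ j) ≡ toℕ i

-- adjacency (edge-sharing unit squares)
Adj : ∀ {n} → Vertex n → Vertex n → Set
Adj {n} (r , c) (r′ , c′) = (r ≡ r′ × Consec c c′) ⊎ (c ≡ c′ × ¬ (r ≡ r′))

-- A subset of the vertex set, stored first-order as a table of booleans.

VSubset : ℕ → Set
VSubset n = Vec (Vec Bool n) 2

_∈V_ : ∀ {n} → Vertex n → VSubset n → Set
(r , c) ∈V B = lookup (lookup B r) c ≡ true

Rel : ℕ → Set
Rel n = Vec (Vec (VSubset n) n) 2

row : ∀ {n} → Rel n → Vertex n → VSubset n
row R (r , c) = lookup (lookup R r) c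

_∼[_]_ : ∀ {n} → Vertex n → Rel n → Vertex n → Set
u ∼[ R ] v = v ∈V row R u

-- R is an equivalence relation (= a set partition of the vertex set)
IsEquivRel : ∀ {n} → Rel n → Set
IsEquivRel {n} R =
  (∀ (u : Vertex n) → u ∼[ R ] u) ×
  (∀ (u v : Vertex n) → u ∼[ R ] v → v ∼[ R ] u) ×
  (∀ (u v w : Vertex n) → u ∼[ R ] v → v ∼[ R ] w → u ∼[ R ] w)

data Reach {n} (S : Vertex n → Set) : Vertex n → Vertex n → Set where
  here : ∀ {u} → Reach S u u
  step : ∀ {u v w} → Reach S u v → Adj v w → S w → Reach S u w

BlocksConnected : ∀ {n} → Rel n → Set
BlocksConnected {n} R =
  ∀ (u v : Vertex n) → u ∼[ R ] v → Reach (λ w → u ∼[ R ] w) u v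

NumBlocks : ∀ {n} → Rel n → ℕ → Set
NumBlocks {n} R j = IsCount (λ (B : VSubset n) → ∃ λ (u : Vertex n) → row R u ≡ B) j

IsConnPartition : ∀ {n} → ℕ → Rel n → Set
IsConnPartition j R = IsEquivRel R × BlocksConnected R × NumBlocks R j

r≡ : ℕ → ℕ → ℕ → Set
r≡ j n m = IsCount (IsConnPartition {n} j) m

-- Polynomials with rational coefficients of degree exactly k:
-- coefficient vector c₀ … c_k, evaluated by Horner's rule.

evalPoly : ∀ {d} → Vec ℚ d → ℚ → ℚ
evalPoly []       x = ℚ.0ℚ
evalPoly (c ∷ cs) x = c ℚ.+ x ℚ.* evalPoly cs x

leadCoeff : ∀ {k} → Vec ℚ (suc k) → ℚ
leadCoeff {k} cs = lookup cs (Data.Fin.fromℕ k)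

ℕ→ℚ : ℕ → ℚ
ℕ→ℚ m = (+ m) / 1

lead : ℕ → ℚ
lead k = (+ (3 ^ k)) / (k !) where instance _ = k !≢0

{-# OPTIONS --safe #-}
module Submission where

-- Cut the ladder after its first column.  A connected partition of the ladder with m + 2 columns is
-- determined by its restriction to the last m + 1 columns (still connected: a detour through the first
-- column can be replaced by the vertical edge of the second) together with which of the three edges
-- of the first column lie inside a block; the admissible choices depend only on whether the two cells
-- of the old first column share a block.  Counting partitions with m + 1 columns and 2 (m + 1) − e
-- blocks whose first column is joined (T m e) or split (D m e) gives the transfer recurrences
--   T (m + 1) e = T m (e − 1) + T m (e − 2) + D m (e − 1) + 2 D m (e − 2),
--   D (m + 1) e = T m e + 2 T m (e − 1) + D m e + 2 D m (e − 1) + D m (e − 2).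
-- By induction on e, both D m e and T m (e + 1) are eventually polynomial in m of degree e with e-th
-- difference 3 ^ e, the first difference of D m (e + 1) collecting three such leading terms.  Hence
-- r_{2n−k}(n) = T (n − 1) k + D (n − 1) k is eventually a polynomial of degree k with leading
-- coefficient 3 ^ k / k!.

module Binomial where

  open import Data.Nat using (ℕ; zero; suc; _+_; _*_)
  open import Relation.Binary.PropositionalEquality
  open import Data.Nat.Solver
  open +-*-Solver

  -- Unlike Data.Nat.Combinatorics._C_, this satisfies Pascal's rule by definition.
  choose : ℕ → ℕ → ℕ
  choose n zero = 1
  choose zero (suc k) = 0
  choose (suc n) (suc k) = choose n k + choose n (suc k)

  choose-absorption : ∀ n k → suc k * choose n (suc k) + k * choose n k ≡ n * choose n k
  choose-absorption zero zero = refl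
  choose-absorption zero (suc k) = solve 1 (λ k → (con 2 :+ k) :* con 0 :+ (con 1 :+ k) :* con 0 := con 0) refl k
  choose-absorption (suc n) zero = begin
      1 * (1 + B1) + 0     ≡⟨ solve 1 (λ b → con 1 :* (con 1 :+ b) :+ con 0 := con 1 :+ (con 1 :* b :+ con 0)) refl B1 ⟩
      suc (1 * B1 + 0)     ≡⟨ cong suc (choose-absorption n zero) ⟩
      suc (n * 1)          ≡⟨ solve 1 (λ n → con 1 :+ n :* con 1 := (con 1 :+ n) :* con 1) refl n ⟩
      suc n * 1            ∎
    where
    open ≡-Reasoning
    B1 : ℕ
    B1 = choose n 1
  choose-absorption (suc n) (suc k) = begin
      suc (suc k) * (B1 + B2) + suc k * (B0 + B1)
        ≡⟨ solve 4 (λ k b0 b1 b2 → (con 2 :+ k) :* (b1 :+ b2) :+ (con 1 :+ k) :* (b0 :+ b1)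
             := ((con 2 :+ k) :* b2 :+ (con 1 :+ k) :* b1) :+ ((con 1 :+ k) :* b1 :+ k :* b0) :+ b1 :+ b0) refl k B0 B1 B2 ⟩
      (suc (suc k) * B2 + suc k * B1) + (suc k * B1 + k * B0) + B1 + B0
        ≡⟨ cong₂ (λ x y → x + y + B1 + B0) (choose-absorption n (suc k)) (choose-absorption n k) ⟩
      n * B1 + n * B0 + B1 + B0
        ≡⟨ solve 3 (λ n b0 b1 → n :* b1 :+ n :* b0 :+ b1 :+ b0 := (con 1 :+ n) :* (b0 :+ b1)) refl n B0 B1 ⟩
      suc n * (B0 + B1) ∎
    where
    open ≡-Reasoning
    B0 B1 B2 : ℕ
    B0 = choose n k
    B1 = choose n (suc k)
    B2 = choose n (suc (suc k))

module Polynomials where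

  open import Data.Nat as ℕ using (ℕ; zero; suc; _≤_; _⊔_; s≤s; _!; _^_)
  import Data.Nat.Properties as ℕₚ
  import Data.Integer as ℤ
  import Data.Integer.Properties as ℤₚ
  open import Data.Rational using (ℚ; _/_; 0ℚ; 1ℚ; _+_; _*_; _-_; -_; toℚᵘ; fromℚᵘ)
  open import Data.Rational.Properties
  import Data.Rational.Unnormalised as ℚᵘ
  import Data.Rational.Unnormalised.Properties as ℚᵘₚ
  open import Data.Vec using (Vec; []; _∷_; _∷ʳ_; last; zipWith; map; initLast)
  import Data.Vec.Properties as Vecₚ
  open import Data.Fin using (fromℕ)
  open import Data.Product using (Σ; _×_; _,_)
  open import Relation.Binary.PropositionalEquality
  open import Data.Rational.Solver
  open +-*-Solver
  open import Defs using (ℕ→ℚ; evalPoly; leadCoeff; lead)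
  open Binomial

  fromℚᵘ-homo-+ : ∀ p q → fromℚᵘ (p ℚᵘ.+ q) ≡ fromℚᵘ p + fromℚᵘ q
  fromℚᵘ-homo-+ p q = toℚᵘ-injective (begin
      toℚᵘ (fromℚᵘ (p ℚᵘ.+ q))              ≈⟨ toℚᵘ-fromℚᵘ (p ℚᵘ.+ q) ⟩
      p ℚᵘ.+ q                              ≈⟨ ℚᵘₚ.+-cong (toℚᵘ-fromℚᵘ p) (toℚᵘ-fromℚᵘ q) ⟨
      toℚᵘ (fromℚᵘ p) ℚᵘ.+ toℚᵘ (fromℚᵘ q)  ≈⟨ toℚᵘ-homo-+ (fromℚᵘ p) (fromℚᵘ q) ⟨
      toℚᵘ (fromℚᵘ p + fromℚᵘ q)            ∎)
    where open ℚᵘₚ.≃-Reasoning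

  fromℚᵘ-homo-* : ∀ p q → fromℚᵘ (p ℚᵘ.* q) ≡ fromℚᵘ p * fromℚᵘ q
  fromℚᵘ-homo-* p q = toℚᵘ-injective (begin
      toℚᵘ (fromℚᵘ (p ℚᵘ.* q))              ≈⟨ toℚᵘ-fromℚᵘ (p ℚᵘ.* q) ⟩
      p ℚᵘ.* q                              ≈⟨ ℚᵘₚ.*-cong (toℚᵘ-fromℚᵘ p) (toℚᵘ-fromℚᵘ q) ⟨
      toℚᵘ (fromℚᵘ p) ℚᵘ.* toℚᵘ (fromℚᵘ q)  ≈⟨ toℚᵘ-homo-* (fromℚᵘ p) (fromℚᵘ q) ⟨
      toℚᵘ (fromℚᵘ p * fromℚᵘ q)            ∎)
    where open ℚᵘₚ.≃-Reasoning

  -- ℕ→ℚ a and ℤ.+ a / suc d are by definition fromℚᵘ (mkℚᵘ (ℤ.+ a) d), so their arithmetic reduces to ℚᵘ.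
  ℕ→ℚ-homo-+ : ∀ a b → ℕ→ℚ (a ℕ.+ b) ≡ ℕ→ℚ a + ℕ→ℚ b
  ℕ→ℚ-homo-+ a b = trans
    (cong (λ z → fromℚᵘ (ℚᵘ.mkℚᵘ z 0)) (sym (cong₂ ℤ._+_ (ℤₚ.*-identityʳ (ℤ.+ a)) (ℤₚ.*-identityʳ (ℤ.+ b)))))
    (fromℚᵘ-homo-+ (ℚᵘ.mkℚᵘ (ℤ.+ a) 0) (ℚᵘ.mkℚᵘ (ℤ.+ b) 0))

  ℕ→ℚ-homo-* : ∀ a b → ℕ→ℚ (a ℕ.* b) ≡ ℕ→ℚ a * ℕ→ℚ b
  ℕ→ℚ-homo-* a b = trans
    (cong (λ z → fromℚᵘ (ℚᵘ.mkℚᵘ z 0)) (ℤₚ.pos-* a b))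
    (fromℚᵘ-homo-* (ℚᵘ.mkℚᵘ (ℤ.+ a) 0) (ℚᵘ.mkℚᵘ (ℤ.+ b) 0))

  1/ℕ : (n : ℕ) → .{{ℕ.NonZero n}} → ℚ
  1/ℕ n = ℤ.+ 1 / n

  /-≡-*1/ℕ : ∀ a n .{{_ : ℕ.NonZero n}} → ℤ.+ a / n ≡ ℕ→ℚ a * 1/ℕ n
  /-≡-*1/ℕ a (suc n) = trans
    (cong₂ (λ z d → fromℚᵘ (ℚᵘ.mkℚᵘ z d)) (sym (ℤₚ.*-identityʳ (ℤ.+ a))) (sym (ℕₚ.+-identityʳ n)))
    (fromℚᵘ-homo-* (ℚᵘ.mkℚᵘ (ℤ.+ a) 0) (ℚᵘ.mkℚᵘ (ℤ.+ 1) n))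

  1/ℕ-homo-* : ∀ m n .{{_ : ℕ.NonZero m}} .{{_ : ℕ.NonZero n}} .{{_ : ℕ.NonZero (m ℕ.* n)}} →
    1/ℕ m * 1/ℕ n ≡ 1/ℕ (m ℕ.* n)
  1/ℕ-homo-* (suc m) (suc n) = sym (fromℚᵘ-homo-* (ℚᵘ.mkℚᵘ (ℤ.+ 1) m) (ℚᵘ.mkℚᵘ (ℤ.+ 1) n))

  1/ℕ-inverseˡ : ∀ n .{{_ : ℕ.NonZero n}} → 1/ℕ n * ℕ→ℚ n ≡ 1ℚ
  1/ℕ-inverseˡ (suc n) = trans
    (sym (fromℚᵘ-homo-* (ℚᵘ.mkℚᵘ (ℤ.+ 1) n) (ℚᵘ.mkℚᵘ (ℤ.+ suc n) 0)))
    (fromℚᵘ-cong {ℚᵘ.mkℚᵘ (ℤ.+ 1) n ℚᵘ.* ℚᵘ.mkℚᵘ (ℤ.+ suc n) 0} {ℚᵘ.1ℚᵘ} (ℚᵘ.*≡* cross-multiplied))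
    where
    cross-multiplied : (ℤ.+ 1 ℤ.* ℤ.+ suc n) ℤ.* ℤ.+ 1 ≡ ℤ.+ 1 ℤ.* ℤ.+ (suc n ℕ.* 1)
    cross-multiplied = trans (ℤₚ.*-identityʳ _) (trans (ℤₚ.*-identityˡ _)
      (sym (trans (ℤₚ.*-identityˡ _) (cong ℤ.+_ (ℕₚ.*-identityʳ (suc n))))))

  sumBelow : (ℕ → ℚ) → ℕ → ℚ
  sumBelow g zero = 0ℚ
  sumBelow g (suc n) = sumBelow g n + g n

  sumBelow-cong : ∀ {g h} → (∀ m → g m ≡ h m) → ∀ n → sumBelow g n ≡ sumBelow h n
  sumBelow-cong g≗h zero = refl
  sumBelow-cong g≗h (suc n) = cong₂ _+_ (sumBelow-cong g≗h n) (g≗h n)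

  sumBelow-+ : ∀ g h n → sumBelow (λ m → g m + h m) n ≡ sumBelow g n + sumBelow h n
  sumBelow-+ g h zero = sym (+-identityʳ 0ℚ)
  sumBelow-+ g h (suc n) = trans (cong (_+ (g n + h n)) (sumBelow-+ g h n))
    (solve 4 (λ a b c d → (a :+ b) :+ (c :+ d) := (a :+ c) :+ (b :+ d)) refl (sumBelow g n) (sumBelow h n) (g n) (h n))

  sumBelow-*ˡ : ∀ c g n → sumBelow (λ m → c * g m) n ≡ c * sumBelow g n
  sumBelow-*ˡ c g zero = sym (*-zeroʳ c)
  sumBelow-*ˡ c g (suc n) = trans (cong (_+ (c * g n)) (sumBelow-*ˡ c g n)) (sym (*-distribˡ-+ c (sumBelow g n) (g n)))

  sumBelow-0 : ∀ n → sumBelow (λ _ → 0ℚ) n ≡ 0ℚ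
  sumBelow-0 zero = refl
  sumBelow-0 (suc n) = trans (+-identityʳ _) (sumBelow-0 n)

  sumBelow-suc : ∀ g n → sumBelow g (suc n) ≡ g 0 + sumBelow (λ m → g (suc m)) n
  sumBelow-suc g zero = +-comm 0ℚ (g 0)
  sumBelow-suc g (suc n) = trans (cong (_+ g (suc n)) (sumBelow-suc g n)) (+-assoc (g 0) (sumBelow (λ m → g (suc m)) n) (g (suc n)))

  sumBelow-choose : ∀ k n → sumBelow (λ m → ℕ→ℚ (choose m k)) n ≡ ℕ→ℚ (choose n (suc k))
  sumBelow-choose k zero = refl
  sumBelow-choose k (suc n) = begin
      sumBelow (λ m → ℕ→ℚ (choose m k)) n + ℕ→ℚ (choose n k)
        ≡⟨ cong (_+ ℕ→ℚ (choose n k)) (sumBelow-choose k n) ⟩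
      ℕ→ℚ (choose n (suc k)) + ℕ→ℚ (choose n k)
        ≡⟨ +-comm (ℕ→ℚ (choose n (suc k))) (ℕ→ℚ (choose n k)) ⟩
      ℕ→ℚ (choose n k) + ℕ→ℚ (choose n (suc k))
        ≡⟨ ℕ→ℚ-homo-+ (choose n k) (choose n (suc k)) ⟨
      ℕ→ℚ (choose (suc n) (suc k)) ∎
    where open ≡-Reasoning

  -- newton a n = Σᵢ aᵢ · C(n, i), written with partial sums so that antidifferences are immediate.
  newton : ∀ {d} → Vec ℚ d → ℕ → ℚ
  newton [] n = 0ℚ
  newton (a ∷ as) n = a + sumBelow (newton as) n

  newton-∷ʳ : ∀ {l} (as : Vec ℚ l) c n → newton (as ∷ʳ c) n ≡ newton as n + c * ℕ→ℚ (choose n l)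
  newton-∷ʳ [] c n = begin
      c + sumBelow (newton []) n  ≡⟨ cong (c +_) (sumBelow-0 n) ⟩
      c + 0ℚ                      ≡⟨ solve 1 (λ c → c :+ con 0ℚ := con 0ℚ :+ c :* con 1ℚ) refl c ⟩
      0ℚ + c * 1ℚ                 ∎
    where open ≡-Reasoning
  newton-∷ʳ {suc l} (a ∷ as) c n = begin
      a + sumBelow (newton (as ∷ʳ c)) n
        ≡⟨ cong (a +_) (sumBelow-cong (λ m → newton-∷ʳ as c m) n) ⟩
      a + sumBelow (λ m → newton as m + c * ℕ→ℚ (choose m l)) n
        ≡⟨ cong (a +_) (sumBelow-+ (newton as) (λ m → c * ℕ→ℚ (choose m l)) n) ⟩
      a + (sumBelow (newton as) n + sumBelow (λ m → c * ℕ→ℚ (choose m l)) n)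
        ≡⟨ cong (λ s → a + (sumBelow (newton as) n + s)) (sumBelow-*ˡ c (λ m → ℕ→ℚ (choose m l)) n) ⟩
      a + (sumBelow (newton as) n + c * sumBelow (λ m → ℕ→ℚ (choose m l)) n)
        ≡⟨ cong (λ s → a + (sumBelow (newton as) n + c * s)) (sumBelow-choose l n) ⟩
      a + (sumBelow (newton as) n + c * ℕ→ℚ (choose n (suc l)))
        ≡⟨ +-assoc a _ _ ⟨
      a + sumBelow (newton as) n + c * ℕ→ℚ (choose n (suc l)) ∎
    where open ≡-Reasoning

  newton-zipWith : ∀ {d} (as bs : Vec ℚ d) n → newton (zipWith _+_ as bs) n ≡ newton as n + newton bs n
  newton-zipWith [] [] n = sym (+-identityʳ 0ℚ)
  newton-zipWith (a ∷ as) (b ∷ bs) n = begin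
      (a + b) + sumBelow (newton (zipWith _+_ as bs)) n
        ≡⟨ cong ((a + b) +_) (sumBelow-cong (newton-zipWith as bs) n) ⟩
      (a + b) + sumBelow (λ m → newton as m + newton bs m) n
        ≡⟨ cong ((a + b) +_) (sumBelow-+ (newton as) (newton bs) n) ⟩
      (a + b) + (sumBelow (newton as) n + sumBelow (newton bs) n)
        ≡⟨ solve 4 (λ a b s t → (a :+ b) :+ (s :+ t) := (a :+ s) :+ (b :+ t)) refl
                   a b (sumBelow (newton as) n) (sumBelow (newton bs) n) ⟩
      (a + sumBelow (newton as) n) + (b + sumBelow (newton bs) n) ∎
    where open ≡-Reasoning

  last-zipWith : ∀ {d} (f : ℚ → ℚ → ℚ) (as bs : Vec ℚ (suc d)) → last (zipWith f as bs) ≡ f (last as) (last bs)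
  last-zipWith f (a ∷ []) (b ∷ []) = refl
  last-zipWith f (a ∷ a′ ∷ as) (b ∷ b′ ∷ bs) = last-zipWith f (a′ ∷ as) (b′ ∷ bs)

  unshift : ∀ {d} → Vec ℚ (suc d) → Vec ℚ (suc d)
  unshift (a ∷ []) = a ∷ []
  unshift (a ∷ b ∷ bs) = (a - newton (unshift (b ∷ bs)) 0) ∷ unshift (b ∷ bs)

  newton-unshift : ∀ {d} (as : Vec ℚ (suc d)) n → newton (unshift as) (suc n) ≡ newton as n
  newton-unshift (a ∷ []) n = cong (a +_) (trans (sumBelow-0 (suc n)) (sym (sumBelow-0 n)))
  newton-unshift (a ∷ b ∷ bs) n = begin
      (a - z) + sumBelow (newton u) (suc n)
        ≡⟨ cong ((a - z) +_) (sumBelow-suc (newton u) n) ⟩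
      (a - z) + (z + sumBelow (λ m → newton u (suc m)) n)
        ≡⟨ cong (λ s → (a - z) + (z + s)) (sumBelow-cong (newton-unshift (b ∷ bs)) n) ⟩
      (a - z) + (z + sumBelow (newton (b ∷ bs)) n)
        ≡⟨ solve 3 (λ a z s → (a :- z) :+ (z :+ s) := a :+ s) refl a z (sumBelow (newton (b ∷ bs)) n) ⟩
      a + sumBelow (newton (b ∷ bs)) n ∎
    where
    open ≡-Reasoning
    u : Vec ℚ (suc _)
    u = unshift (b ∷ bs)
    z : ℚ
    z = newton u 0

  last-unshift : ∀ {d} (as : Vec ℚ (suc d)) → last (unshift as) ≡ last as
  last-unshift (a ∷ []) = refl
  last-unshift (a ∷ b ∷ bs) = last-unshift (b ∷ bs)

  -- f agrees from some point on with a polynomial of degree ≤ d whose d-th forward difference is c.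
  record EvPoly (d : ℕ) (c : ℚ) (f : ℕ → ℕ) : Set where
    field
      coeffs    : Vec ℚ (suc d)
      last≡     : last coeffs ≡ c
      threshold : ℕ
      agrees    : ∀ m → threshold ≤ m → ℕ→ℚ (f m) ≡ newton coeffs m
  open EvPoly

  EvPoly-cong : ∀ {d c c′ f g} → c ≡ c′ → (∀ m → f m ≡ g m) → EvPoly d c f → EvPoly d c′ g
  EvPoly-cong refl f≗g P = record
    { coeffs = coeffs P ; last≡ = last≡ P ; threshold = threshold P
    ; agrees = λ m N≤m → trans (cong ℕ→ℚ (sym (f≗g m))) (agrees P m N≤m) }

  EvPoly-const : ∀ v → EvPoly 0 (ℕ→ℚ v) (λ _ → v)
  EvPoly-const v = record
    { coeffs = ℕ→ℚ v ∷ [] ; last≡ = refl ; threshold = 0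
    ; agrees = λ m _ → sym (trans (cong (ℕ→ℚ v +_) (sumBelow-0 m)) (+-identityʳ _)) }

  EvPoly-raise : ∀ {d c f} → EvPoly d c f → EvPoly (suc d) 0ℚ f
  EvPoly-raise {d} P = record
    { coeffs = coeffs P ∷ʳ 0ℚ ; last≡ = Vecₚ.last-∷ʳ 0ℚ (coeffs P) ; threshold = threshold P
    ; agrees = λ m N≤m → trans (agrees P m N≤m) (sym (begin
        newton (coeffs P ∷ʳ 0ℚ) m
          ≡⟨ newton-∷ʳ (coeffs P) 0ℚ m ⟩
        newton (coeffs P) m + 0ℚ * ℕ→ℚ (choose m (suc d))
          ≡⟨ cong (newton (coeffs P) m +_) (*-zeroˡ (ℕ→ℚ (choose m (suc d)))) ⟩
        newton (coeffs P) m + 0ℚ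
          ≡⟨ +-identityʳ _ ⟩
        newton (coeffs P) m ∎)) }
    where open ≡-Reasoning

  EvPoly-zero : ∀ d → EvPoly d 0ℚ (λ _ → 0)
  EvPoly-zero zero = EvPoly-const 0
  EvPoly-zero (suc d) = EvPoly-raise (EvPoly-zero d)

  EvPoly-+ : ∀ {d c c′ f g} → EvPoly d c f → EvPoly d c′ g → EvPoly d (c + c′) (λ m → f m ℕ.+ g m)
  EvPoly-+ {f = f} {g} P Q = record
    { coeffs = zipWith _+_ (coeffs P) (coeffs Q)
    ; last≡ = trans (last-zipWith _+_ (coeffs P) (coeffs Q)) (cong₂ _+_ (last≡ P) (last≡ Q))
    ; threshold = threshold P ⊔ threshold Q
    ; agrees = λ m N≤m → begin
        ℕ→ℚ (f m ℕ.+ g m)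
          ≡⟨ ℕ→ℚ-homo-+ (f m) (g m) ⟩
        ℕ→ℚ (f m) + ℕ→ℚ (g m)
          ≡⟨ cong₂ _+_ (agrees P m (ℕₚ.m⊔n≤o⇒m≤o _ _ N≤m)) (agrees Q m (ℕₚ.m⊔n≤o⇒n≤o _ _ N≤m)) ⟩
        newton (coeffs P) m + newton (coeffs Q) m
          ≡⟨ newton-zipWith (coeffs P) (coeffs Q) m ⟨
        newton (zipWith _+_ (coeffs P) (coeffs Q)) m ∎ }
    where open ≡-Reasoning

  EvPoly-2* : ∀ {d c f} → EvPoly d c f → EvPoly d (c + (c + 0ℚ)) (λ m → 2 ℕ.* f m)
  EvPoly-2* {d} F = EvPoly-+ F (EvPoly-+ F (EvPoly-zero d))

  EvPoly-unshift : ∀ {d c f} → EvPoly d c (λ m → f (suc m)) → EvPoly d c f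
  EvPoly-unshift P = record
    { coeffs = unshift (coeffs P) ; last≡ = trans (last-unshift (coeffs P)) (last≡ P) ; threshold = suc (threshold P)
    ; agrees = λ where (suc m) (s≤s N≤m) → trans (agrees P m N≤m) (sym (newton-unshift (coeffs P) m)) }

  EvPoly-antidiff : ∀ {d c f g} → (∀ m → f (suc m) ≡ f m ℕ.+ g m) → EvPoly d c g → EvPoly (suc d) c f
  EvPoly-antidiff {f = f} {g} f-step P = record
    { coeffs = a₀ ∷ coeffs P ; last≡ = last≡ P ; threshold = N
    ; agrees = λ m N≤m →
        subst (λ z → ℕ→ℚ (f z) ≡ newton (a₀ ∷ coeffs P) z) (ℕₚ.m∸n+n≡m N≤m) (from-N (m ℕ.∸ N)) }
    where
    N : ℕ
    N = threshold P
    S : ℕ → ℚ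
    S = sumBelow (newton (coeffs P))
    a₀ : ℚ
    a₀ = ℕ→ℚ (f N) - S N
    from-N : ∀ i → ℕ→ℚ (f (i ℕ.+ N)) ≡ a₀ + S (i ℕ.+ N)
    from-N zero = solve 2 (λ x s → x := (x :- s) :+ s) refl (ℕ→ℚ (f N)) (S N)
    from-N (suc i) = begin
        ℕ→ℚ (f (suc (i ℕ.+ N)))                          ≡⟨ cong ℕ→ℚ (f-step (i ℕ.+ N)) ⟩
        ℕ→ℚ (f (i ℕ.+ N) ℕ.+ g (i ℕ.+ N))                ≡⟨ ℕ→ℚ-homo-+ (f (i ℕ.+ N)) (g (i ℕ.+ N)) ⟩
        ℕ→ℚ (f (i ℕ.+ N)) + ℕ→ℚ (g (i ℕ.+ N))            ≡⟨ cong₂ _+_ (from-N i) (agrees P (i ℕ.+ N) (ℕₚ.m≤n+m N i)) ⟩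
        (a₀ + S (i ℕ.+ N)) + newton (coeffs P) (i ℕ.+ N) ≡⟨ +-assoc a₀ _ _ ⟩
        a₀ + S (suc (i ℕ.+ N))                           ∎
      where open ≡-Reasoning

  infixl 6 _+ᵖ_
  infixr 7 _·ᵖ_

  _+ᵖ_ : ∀ {d} → Vec ℚ d → Vec ℚ d → Vec ℚ d
  _+ᵖ_ = zipWith _+_

  _·ᵖ_ : ∀ {d} → ℚ → Vec ℚ d → Vec ℚ d
  c ·ᵖ P = map (c *_) P

  evalPoly-+ᵖ : ∀ {d} (P Q : Vec ℚ d) x → evalPoly (P +ᵖ Q) x ≡ evalPoly P x + evalPoly Q x
  evalPoly-+ᵖ [] [] x = sym (+-identityʳ 0ℚ)
  evalPoly-+ᵖ (p ∷ P) (q ∷ Q) x = trans (cong (λ z → (p + q) + x * z) (evalPoly-+ᵖ P Q x))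
    (solve 5 (λ p q x a b → (p :+ q) :+ x :* (a :+ b) := (p :+ x :* a) :+ (q :+ x :* b)) refl p q x (evalPoly P x) (evalPoly Q x))

  evalPoly-·ᵖ : ∀ {d} c (P : Vec ℚ d) x → evalPoly (c ·ᵖ P) x ≡ c * evalPoly P x
  evalPoly-·ᵖ c [] x = sym (*-zeroʳ c)
  evalPoly-·ᵖ c (p ∷ P) x = trans (cong (λ z → c * p + x * z) (evalPoly-·ᵖ c P x))
    (solve 4 (λ c p x a → c :* p :+ x :* (c :* a) := c :* (p :+ x :* a)) refl c p x (evalPoly P x))

  evalPoly-∷ʳ0 : ∀ {d} (P : Vec ℚ d) x → evalPoly (P ∷ʳ 0ℚ) x ≡ evalPoly P x
  evalPoly-∷ʳ0 [] x = trans (+-identityˡ (x * 0ℚ)) (*-zeroʳ x)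
  evalPoly-∷ʳ0 (p ∷ P) x = cong (λ z → p + x * z) (evalPoly-∷ʳ0 P x)

  leadCoeff-+ᵖ : ∀ {d} (P Q : Vec ℚ (suc d)) → leadCoeff (P +ᵖ Q) ≡ leadCoeff P + leadCoeff Q
  leadCoeff-+ᵖ {d} P Q = Vecₚ.lookup-zipWith _+_ (fromℕ d) P Q

  leadCoeff-·ᵖ : ∀ {d} c (P : Vec ℚ (suc d)) → leadCoeff (c ·ᵖ P) ≡ c * leadCoeff P
  leadCoeff-·ᵖ {d} c P = Vecₚ.lookup-map (fromℕ d) (c *_) P

  leadCoeff-∷ʳ : ∀ {d} (P : Vec ℚ d) y → leadCoeff (P ∷ʳ y) ≡ y
  leadCoeff-∷ʳ [] y = refl
  leadCoeff-∷ʳ (x ∷ P) y = leadCoeff-∷ʳ P y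

  mulLinear : ∀ {d} → ℚ → Vec ℚ (suc d) → Vec ℚ (suc (suc d))
  mulLinear c P = (0ℚ ∷ P) +ᵖ ((- c ·ᵖ P) ∷ʳ 0ℚ)

  evalPoly-mulLinear : ∀ {d} c (P : Vec ℚ (suc d)) x → evalPoly (mulLinear c P) x ≡ (x - c) * evalPoly P x
  evalPoly-mulLinear c P x = begin
      evalPoly ((0ℚ ∷ P) +ᵖ ((- c ·ᵖ P) ∷ʳ 0ℚ)) x
        ≡⟨ evalPoly-+ᵖ (0ℚ ∷ P) ((- c ·ᵖ P) ∷ʳ 0ℚ) x ⟩
      (0ℚ + x * evalPoly P x) + evalPoly ((- c ·ᵖ P) ∷ʳ 0ℚ) x
        ≡⟨ cong ((0ℚ + x * evalPoly P x) +_) (trans (evalPoly-∷ʳ0 (- c ·ᵖ P) x) (evalPoly-·ᵖ (- c) P x)) ⟩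
      (0ℚ + x * evalPoly P x) + - c * evalPoly P x
        ≡⟨ solve 3 (λ c x a → (con 0ℚ :+ x :* a) :+ (:- c) :* a := (x :- c) :* a) refl c x (evalPoly P x) ⟩
      (x - c) * evalPoly P x ∎
    where open ≡-Reasoning

  leadCoeff-mulLinear : ∀ {d} c (P : Vec ℚ (suc d)) → leadCoeff (mulLinear c P) ≡ leadCoeff P
  leadCoeff-mulLinear c P = begin
      leadCoeff ((0ℚ ∷ P) +ᵖ ((- c ·ᵖ P) ∷ʳ 0ℚ))  ≡⟨ leadCoeff-+ᵖ (0ℚ ∷ P) ((- c ·ᵖ P) ∷ʳ 0ℚ) ⟩
      leadCoeff P + leadCoeff ((- c ·ᵖ P) ∷ʳ 0ℚ)  ≡⟨ cong (leadCoeff P +_) (leadCoeff-∷ʳ (- c ·ᵖ P) 0ℚ) ⟩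
      leadCoeff P + 0ℚ                           ≡⟨ +-identityʳ (leadCoeff P) ⟩
      leadCoeff P                                ∎
    where open ≡-Reasoning

  binomialPoly : ∀ i → Vec ℚ (suc i)
  binomialPoly zero = 1ℚ ∷ []
  binomialPoly (suc i) = 1/ℕ (suc i) ·ᵖ mulLinear (ℕ→ℚ i) (binomialPoly i)

  leadCoeff-binomialPoly : ∀ i → leadCoeff (binomialPoly i) ≡ 1/ℕ (i !) {{i ℕₚ.!≢0}}
  leadCoeff-binomialPoly zero = refl
  leadCoeff-binomialPoly (suc i) = begin
      leadCoeff (1/ℕ (suc i) ·ᵖ mulLinear (ℕ→ℚ i) (binomialPoly i))
        ≡⟨ leadCoeff-·ᵖ (1/ℕ (suc i)) (mulLinear (ℕ→ℚ i) (binomialPoly i)) ⟩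
      1/ℕ (suc i) * leadCoeff (mulLinear (ℕ→ℚ i) (binomialPoly i))
        ≡⟨ cong (1/ℕ (suc i) *_) (trans (leadCoeff-mulLinear (ℕ→ℚ i) (binomialPoly i)) (leadCoeff-binomialPoly i)) ⟩
      1/ℕ (suc i) * 1/ℕ (i !) {{i ℕₚ.!≢0}}
        ≡⟨ 1/ℕ-homo-* (suc i) (i !) {{_}} {{i ℕₚ.!≢0}} {{suc i ℕₚ.!≢0}} ⟩
      1/ℕ (suc i !) {{suc i ℕₚ.!≢0}} ∎
    where open ≡-Reasoning

  evalPoly-binomialPoly : ∀ i n → evalPoly (binomialPoly i) (ℕ→ℚ n) ≡ ℕ→ℚ (choose n i)
  evalPoly-binomialPoly zero n = trans (cong (1ℚ +_) (*-zeroʳ (ℕ→ℚ n))) (+-identityʳ 1ℚ)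
  evalPoly-binomialPoly (suc i) n = begin
      evalPoly (1/ℕ (suc i) ·ᵖ mulLinear I (binomialPoly i)) x
        ≡⟨ evalPoly-·ᵖ (1/ℕ (suc i)) (mulLinear I (binomialPoly i)) x ⟩
      1/ℕ (suc i) * evalPoly (mulLinear I (binomialPoly i)) x
        ≡⟨ cong (1/ℕ (suc i) *_) (evalPoly-mulLinear I (binomialPoly i) x) ⟩
      1/ℕ (suc i) * ((x - I) * evalPoly (binomialPoly i) x)
        ≡⟨ cong (λ z → 1/ℕ (suc i) * ((x - I) * z)) (evalPoly-binomialPoly i n) ⟩
      1/ℕ (suc i) * ((x - I) * B)
        ≡⟨ cong (1/ℕ (suc i) *_) (solve 3 (λ x I B → (x :- I) :* B := x :* B :- I :* B) refl x I B) ⟩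
      1/ℕ (suc i) * (x * B - I * B)
        ≡⟨ cong (λ z → 1/ℕ (suc i) * (z - I * B)) absorption ⟨
      1/ℕ (suc i) * ((S * B′ + I * B) - I * B)
        ≡⟨ solve 5 (λ v S B′ I B → v :* ((S :* B′ :+ I :* B) :- I :* B) := (v :* S) :* B′) refl (1/ℕ (suc i)) S B′ I B ⟩
      (1/ℕ (suc i) * S) * B′
        ≡⟨ cong (_* B′) (1/ℕ-inverseˡ (suc i)) ⟩
      1ℚ * B′
        ≡⟨ *-identityˡ B′ ⟩
      B′ ∎
    where
    open ≡-Reasoning
    x I S B B′ : ℚ
    x = ℕ→ℚ n
    I = ℕ→ℚ i
    S = ℕ→ℚ (suc i)
    B = ℕ→ℚ (choose n i)
    B′ = ℕ→ℚ (choose n (suc i))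
    absorption : S * B′ + I * B ≡ x * B
    absorption = begin
        S * B′ + I * B
          ≡⟨ cong₂ _+_ (ℕ→ℚ-homo-* (suc i) (choose n (suc i))) (ℕ→ℚ-homo-* i (choose n i)) ⟨
        ℕ→ℚ (suc i ℕ.* choose n (suc i)) + ℕ→ℚ (i ℕ.* choose n i)
          ≡⟨ ℕ→ℚ-homo-+ (suc i ℕ.* choose n (suc i)) (i ℕ.* choose n i) ⟨
        ℕ→ℚ (suc i ℕ.* choose n (suc i) ℕ.+ i ℕ.* choose n i)
          ≡⟨ cong ℕ→ℚ (choose-absorption n i) ⟩
        ℕ→ℚ (n ℕ.* choose n i)
          ≡⟨ ℕ→ℚ-homo-* n (choose n i) ⟩
        x * B ∎

  newton-as-polynomial : ∀ {d} (as : Vec ℚ (suc d)) → Σ (Vec ℚ (suc d)) λ P →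
    leadCoeff P ≡ last as * 1/ℕ (d !) {{d ℕₚ.!≢0}} × (∀ n → evalPoly P (ℕ→ℚ n) ≡ newton as n)
  newton-as-polynomial {zero} (a ∷ []) = (a ∷ []) , sym (*-identityʳ a) , λ n → begin
      a + ℕ→ℚ n * 0ℚ         ≡⟨ cong (a +_) (*-zeroʳ (ℕ→ℚ n)) ⟩
      a + 0ℚ                 ≡⟨ cong (a +_) (sumBelow-0 n) ⟨
      a + sumBelow (λ _ → 0ℚ) n ∎
    where open ≡-Reasoning
  newton-as-polynomial {suc d} as with initLast as
  ... | as′ , c , refl with newton-as-polynomial as′
  ... | P′ , _ , eval-P′ = P , lead-P , eval-P
    where
    open ≡-Reasoning
    P : Vec ℚ (suc (suc d))
    P = (P′ ∷ʳ 0ℚ) +ᵖ (c ·ᵖ binomialPoly (suc d))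
    lead-P : leadCoeff P ≡ c * 1/ℕ (suc d !) {{suc d ℕₚ.!≢0}}
    lead-P = begin
      leadCoeff P
        ≡⟨ leadCoeff-+ᵖ (P′ ∷ʳ 0ℚ) (c ·ᵖ binomialPoly (suc d)) ⟩
      leadCoeff (P′ ∷ʳ 0ℚ) + leadCoeff (c ·ᵖ binomialPoly (suc d))
        ≡⟨ cong₂ _+_ (leadCoeff-∷ʳ P′ 0ℚ) (leadCoeff-·ᵖ c (binomialPoly (suc d))) ⟩
      0ℚ + c * leadCoeff (binomialPoly (suc d))
        ≡⟨ +-identityˡ _ ⟩
      c * leadCoeff (binomialPoly (suc d))
        ≡⟨ cong (c *_) (leadCoeff-binomialPoly (suc d)) ⟩
      c * 1/ℕ (suc d !) {{suc d ℕₚ.!≢0}} ∎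
    eval-P : ∀ n → evalPoly P (ℕ→ℚ n) ≡ newton (as′ ∷ʳ c) n
    eval-P n = begin
      evalPoly P (ℕ→ℚ n)
        ≡⟨ evalPoly-+ᵖ (P′ ∷ʳ 0ℚ) (c ·ᵖ binomialPoly (suc d)) (ℕ→ℚ n) ⟩
      evalPoly (P′ ∷ʳ 0ℚ) (ℕ→ℚ n) + evalPoly (c ·ᵖ binomialPoly (suc d)) (ℕ→ℚ n)
        ≡⟨ cong₂ _+_ (evalPoly-∷ʳ0 P′ (ℕ→ℚ n)) (evalPoly-·ᵖ c (binomialPoly (suc d)) (ℕ→ℚ n)) ⟩
      evalPoly P′ (ℕ→ℚ n) + c * evalPoly (binomialPoly (suc d)) (ℕ→ℚ n)
        ≡⟨ cong₂ (λ u v → u + c * v) (eval-P′ n) (evalPoly-binomialPoly (suc d) n) ⟩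
      newton as′ n + c * ℕ→ℚ (choose n (suc d))
        ≡⟨ newton-∷ʳ as′ c n ⟨
      newton (as′ ∷ʳ c) n ∎

  EvPoly⇒polynomial : ∀ {d c f} → EvPoly d c f → Σ (Vec ℚ (suc d)) λ P →
    leadCoeff P ≡ c * 1/ℕ (d !) {{d ℕₚ.!≢0}} × Σ ℕ λ N → ∀ m → N ≤ m → ℕ→ℚ (f m) ≡ evalPoly P (ℕ→ℚ m)
  EvPoly⇒polynomial F with newton-as-polynomial (coeffs F)
  ... | P , lead-P , eval-P =
    P , trans lead-P (cong (_* _) (last≡ F)) , threshold F , λ m N≤m → trans (agrees F m N≤m) (sym (eval-P m))

  lead≡3^k*1/k! : ∀ k → lead k ≡ ℕ→ℚ (3 ^ k) * 1/ℕ (k !) {{k ℕₚ.!≢0}}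
  lead≡3^k*1/k! k = /-≡-*1/ℕ (3 ^ k) (k !) {{k ℕₚ.!≢0}}

module LinearRecurrence where

  open import Data.Nat as ℕ using (ℕ; zero; suc; _+_; _*_; _^_)
  open import Data.Rational as ℚ using (ℚ; 0ℚ)
  import Data.Rational.Properties as ℚₚ
  open import Data.Product using (_×_; _,_)
  open import Relation.Binary.PropositionalEquality
  open import Defs using (ℕ→ℚ)
  open Polynomials
  import Data.Nat.Solver as ℕ-Solver
  import Data.Rational.Solver as ℚ-Solver

  lag : (ℕ → ℕ) → ℕ → ℕ
  lag g zero = 0
  lag g (suc k) = g k

  module _ (T D : ℕ → ℕ → ℕ)
    (T-base : T 0 0 ≡ 0) (D-base : D 0 0 ≡ 1)
    (T-step : ∀ m k → T (suc m) k ≡ lag (T m) k + lag (lag (T m)) k + lag (D m) k + 2 * lag (lag (D m)) k)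
    (D-step : ∀ m k → D (suc m) k ≡ T m k + 2 * lag (T m) k + D m k + 2 * lag (D m) k + lag (lag (D m)) k)
    where

    T-0 : ∀ m → T m 0 ≡ 0
    T-0 zero = T-base
    T-0 (suc m) = T-step m 0

    D-0 : ∀ m → D m 0 ≡ 1
    D-0 zero = D-base
    D-0 (suc m) = begin
      D (suc m) 0                ≡⟨ D-step m 0 ⟩
      T m 0 + 0 + D m 0 + 0 + 0  ≡⟨ cong₂ (λ t d → t + 0 + d + 0 + 0) (T-0 m) (D-0 m) ⟩
      1                          ∎
      where open ≡-Reasoning

    Invariant : ℕ → Set
    Invariant k = EvPoly k (ℕ→ℚ (3 ^ k)) (λ m → D m k) × EvPoly k 0ℚ (λ m → T m k) ×
                  EvPoly k 0ℚ (λ m → lag (T m) k) × EvPoly k 0ℚ (λ m → lag (D m) k)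

    T-next : ∀ k → Invariant k → EvPoly k (ℕ→ℚ (3 ^ k)) (λ m → T m (suc k))
    T-next k (Dk , Tk , T′k , D′k) = EvPoly-unshift (EvPoly-cong leading (λ m → sym (T-step m (suc k)))
      (EvPoly-+ (EvPoly-+ (EvPoly-+ Tk T′k) Dk) (EvPoly-2* D′k)))
      where
      open ℚ-Solver.+-*-Solver
      leading : 0ℚ ℚ.+ 0ℚ ℚ.+ ℕ→ℚ (3 ^ k) ℚ.+ (0ℚ ℚ.+ (0ℚ ℚ.+ 0ℚ)) ≡ ℕ→ℚ (3 ^ k)
      leading = solve 1 (λ x → con 0ℚ :+ con 0ℚ :+ x :+ (con 0ℚ :+ (con 0ℚ :+ con 0ℚ)) := x) refl (ℕ→ℚ (3 ^ k))

    D-next : ∀ k → Invariant k → EvPoly (suc k) (ℕ→ℚ (3 ^ suc k)) (λ m → D m (suc k))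
    D-next k inv@(Dk , Tk , T′k , D′k) = EvPoly-antidiff D-difference
      (EvPoly-cong leading (λ _ → refl) (EvPoly-+ (EvPoly-+ (EvPoly-+ (T-next k inv) (EvPoly-2* Tk)) (EvPoly-2* Dk)) D′k))
      where
      D-difference : ∀ m → D (suc m) (suc k) ≡ D m (suc k) + (T m (suc k) + 2 * T m k + 2 * D m k + lag (D m) k)
      D-difference m = trans (D-step m (suc k))
        (solve 5 (λ t′ t d′ d l → t′ :+ con 2 :* t :+ d′ :+ con 2 :* d :+ l
                                := d′ :+ (t′ :+ con 2 :* t :+ con 2 :* d :+ l))
               refl (T m (suc k)) (T m k) (D m (suc k)) (D m k) (lag (D m) k))
        where open ℕ-Solver.+-*-Solver
      x : ℚ
      x = ℕ→ℚ (3 ^ k)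
      leading : x ℚ.+ (0ℚ ℚ.+ (0ℚ ℚ.+ 0ℚ)) ℚ.+ (x ℚ.+ (x ℚ.+ 0ℚ)) ℚ.+ 0ℚ ≡ ℕ→ℚ (3 ^ suc k)
      leading = begin
          x ℚ.+ (0ℚ ℚ.+ (0ℚ ℚ.+ 0ℚ)) ℚ.+ (x ℚ.+ (x ℚ.+ 0ℚ)) ℚ.+ 0ℚ
            ≡⟨ solve 1 (λ x → x :+ (con 0ℚ :+ (con 0ℚ :+ con 0ℚ)) :+ (x :+ (x :+ con 0ℚ)) :+ con 0ℚ
                            := x :+ (x :+ (x :+ con 0ℚ))) refl x ⟩
          x ℚ.+ (x ℚ.+ (x ℚ.+ 0ℚ))
            ≡⟨ cong (x ℚ.+_) (cong (x ℚ.+_) (ℕ→ℚ-homo-+ (3 ^ k) 0)) ⟨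
          x ℚ.+ (x ℚ.+ ℕ→ℚ (3 ^ k ℕ.+ 0))
            ≡⟨ cong (x ℚ.+_) (ℕ→ℚ-homo-+ (3 ^ k) (3 ^ k ℕ.+ 0)) ⟨
          x ℚ.+ ℕ→ℚ (3 ^ k ℕ.+ (3 ^ k ℕ.+ 0))
            ≡⟨ ℕ→ℚ-homo-+ (3 ^ k) (3 ^ k ℕ.+ (3 ^ k ℕ.+ 0)) ⟨
          ℕ→ℚ (3 ^ suc k) ∎
        where
        open ≡-Reasoning
        open ℚ-Solver.+-*-Solver

    invariant : ∀ k → Invariant k
    invariant zero = EvPoly-cong refl (λ m → sym (D-0 m)) (EvPoly-const 1) ,
                     EvPoly-cong refl (λ m → sym (T-0 m)) (EvPoly-const 0) ,
                     EvPoly-zero 0 , EvPoly-zero 0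
    invariant (suc k) with invariant k
    ... | inv@(Dk , Tk , _ , _) = D-next k inv , EvPoly-raise (T-next k inv) , EvPoly-raise Tk , EvPoly-raise Dk

    total-EvPoly : ∀ k → EvPoly k (ℕ→ℚ (3 ^ k)) (λ m → T m k + D m k)
    total-EvPoly k with invariant k
    ... | Dk , Tk , _ , _ = EvPoly-cong (ℚₚ.+-identityˡ _) (λ _ → refl) (EvPoly-+ Tk Dk)

module LadderPartitions where

  open import Data.Nat using (ℕ; zero; suc; _+_; _*_; _∸_; _<_; _≤_; s≤s; z≤n)
  import Data.Nat.Properties as ℕₚ
  import Data.Nat.Solver as ℕ-Solver
  open import Data.Nat.ListAction using (sum)
  open import Data.Fin as Fin using (Fin; zero; suc)
  import Data.Fin.Properties as Finₚ
  open import Data.Bool using (Bool; true; false)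
  open import Data.Bool.Properties using (¬-not)
  open import Data.Vec using (lookup; tabulate)
  import Data.Vec.Properties as Vecₚ
  open import Data.List using (List; []; _∷_; length; map; _++_)
  import Data.List.Properties as Listₚ
  open import Data.List.Membership.Propositional using (_∈_)
  open import Data.List.Membership.Propositional.Properties using (∈-map⁺; ∈-map⁻; ∈-++⁺ˡ; ∈-++⁺ʳ; ∈-++⁻)
  open import Data.List.Membership.Propositional.Properties.WithK using (unique∧set⇒bag)
  open import Data.List.Relation.Binary.BagAndSetEquality using (∼bag⇒↭)
  open import Data.List.Relation.Binary.Permutation.Propositional.Properties using (↭-length)
  open import Data.List.Relation.Unary.Any using (here; there)
  open import Data.List.Relation.Unary.All as All using (All; []; _∷_)
  open import Data.List.Relation.Unary.AllPairs using ([]; _∷_)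
  open import Data.List.Relation.Unary.Unique.Propositional using (Unique)
  import Data.List.Relation.Unary.Unique.Propositional.Properties as Uniqueₚ
  open import Data.Product using (Σ; ∃; _×_; _,_; proj₁; proj₂)
  open import Data.Sum using (_⊎_; inj₁; inj₂; [_,_]′)
  open import Data.Empty using (⊥-elim)
  open import Relation.Nullary using (¬_; yes; no)
  open import Function.Bundles using (_⇔_; mk⇔; Equivalence)
  open import Relation.Binary.PropositionalEquality
  open import Defs
  open LinearRecurrence using (lag)

  ⟦_⟧ : ∀ {n} → Rel n → Vertex n → Vertex n → Bool
  ⟦ R ⟧ u v = lookup (lookup (row R u) (proj₁ v)) (proj₂ v)

  mem : ∀ {n} → VSubset n → Vertex n → Bool
  mem B v = lookup (lookup B (proj₁ v)) (proj₂ v)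

  toSubset : ∀ {n} → (Vertex n → Bool) → VSubset n
  toSubset g = tabulate λ r → tabulate λ c → g (r , c)

  toRel : ∀ {n} → (Vertex n → Vertex n → Bool) → Rel n
  toRel f = tabulate λ r → tabulate λ c → toSubset (f (r , c))

  mem-toSubset : ∀ {n} (g : Vertex n → Bool) v → mem (toSubset g) v ≡ g v
  mem-toSubset g (r , c) = trans (cong (λ z → lookup z c) (Vecₚ.lookup∘tabulate (λ r → tabulate λ c → g (r , c)) r))
                                 (Vecₚ.lookup∘tabulate (λ c → g (r , c)) c)

  row-toRel : ∀ {n} (f : Vertex n → Vertex n → Bool) u → row (toRel f) u ≡ toSubset (f u)
  row-toRel f (r , c) = trans (cong (λ z → lookup z c) (Vecₚ.lookup∘tabulate (λ r → tabulate λ c → toSubset (f (r , c))) r))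
                              (Vecₚ.lookup∘tabulate (λ c → toSubset (f (r , c))) c)

  ⟦toRel⟧ : ∀ {n} (f : Vertex n → Vertex n → Bool) u v → ⟦ toRel f ⟧ u v ≡ f u v
  ⟦toRel⟧ f u v = trans (cong (λ B → mem B v) (row-toRel f u)) (mem-toSubset (f u) v)

  toSubset-mem : ∀ {n} (B : VSubset n) → toSubset (mem B) ≡ B
  toSubset-mem B = trans (Vecₚ.tabulate-cong (λ r → Vecₚ.tabulate∘lookup (lookup B r))) (Vecₚ.tabulate∘lookup B)

  VSubset-ext : ∀ {n} {A B : VSubset n} → (∀ v → mem A v ≡ mem B v) → A ≡ B
  VSubset-ext {A = A} {B} A≗B = trans (sym (toSubset-mem A))
    (trans (Vecₚ.tabulate-cong (λ r → Vecₚ.tabulate-cong (λ c → A≗B (r , c)))) (toSubset-mem B))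

  toRel-⟦⟧ : ∀ {n} (R : Rel n) → toRel ⟦ R ⟧ ≡ R
  toRel-⟦⟧ R = trans (Vecₚ.tabulate-cong (λ r → Vecₚ.tabulate-cong (λ c → toSubset-mem (lookup (lookup R r) c))))
    (trans (Vecₚ.tabulate-cong (λ r → Vecₚ.tabulate∘lookup (lookup R r))) (Vecₚ.tabulate∘lookup R))

  Rel-ext : ∀ {n} {R R′ : Rel n} → (∀ u v → ⟦ R ⟧ u v ≡ ⟦ R′ ⟧ u v) → R ≡ R′
  Rel-ext {R = R} {R′} R≗R′ = trans (sym (toRel-⟦⟧ R)) (trans (Vecₚ.tabulate-cong (λ r → Vecₚ.tabulate-cong (λ c →
    Vecₚ.tabulate-cong (λ r′ → Vecₚ.tabulate-cong (λ c′ → R≗R′ (r , c) (r′ , c′)))))) (toRel-⟦⟧ R′))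

  -- IsEquivRel R and BlocksConnected R unfold to IsEquivalenceᵇ ⟦ R ⟧ and BlocksConnectedᵇ ⟦ R ⟧.
  IsEquivalenceᵇ : ∀ {A : Set} → (A → A → Bool) → Set
  IsEquivalenceᵇ f = (∀ u → f u u ≡ true) × (∀ u v → f u v ≡ true → f v u ≡ true) ×
                     (∀ u v w → f u v ≡ true → f v w ≡ true → f u w ≡ true)

  BlocksConnectedᵇ : ∀ {n} → (Vertex n → Vertex n → Bool) → Set
  BlocksConnectedᵇ {n} f = ∀ (u v : Vertex n) → f u v ≡ true → Reach (λ w → f u w ≡ true) u v

  NumBlocksᵇ : ∀ {n} → (Vertex n → Vertex n → Bool) → ℕ → Set
  NumBlocksᵇ {n} f j = IsCount (λ (B : VSubset n) → ∃ λ u → toSubset (f u) ≡ B) j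

  IsConnPartitionᵇ : ∀ {n} → (Vertex n → Vertex n → Bool) → ℕ → Set
  IsConnPartitionᵇ f j = IsEquivalenceᵇ f × BlocksConnectedᵇ f × NumBlocksᵇ f j

  ≡true-⇔⇒≡ : ∀ {P Q : Bool} → (P ≡ true → Q ≡ true) → (Q ≡ true → P ≡ true) → P ≡ Q
  ≡true-⇔⇒≡ {true} {true} _ _ = refl
  ≡true-⇔⇒≡ {true} {false} P⇒Q _ = sym (P⇒Q refl)
  ≡true-⇔⇒≡ {false} {true} _ Q⇒P = Q⇒P refl
  ≡true-⇔⇒≡ {false} {false} _ _ = refl

  symᵇ : ∀ {A : Set} {f : A → A → Bool} → IsEquivalenceᵇ f → ∀ u v → f u v ≡ f v u
  symᵇ (_ , sym-f , _) u v = ≡true-⇔⇒≡ (sym-f u v) (sym-f v u)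

  sameRowᵇ : ∀ {A : Set} {f : A → A → Bool} → IsEquivalenceᵇ f → ∀ u u′ w → f u u′ ≡ true → f u w ≡ f u′ w
  sameRowᵇ (_ , sym-f , trans-f) u u′ w u∼u′ = ≡true-⇔⇒≡ (trans-f u′ u w (sym-f u u′ u∼u′)) (trans-f u u′ w u∼u′)

  IsEquivalenceᵇ-cong : ∀ {A : Set} {f g : A → A → Bool} → (∀ u v → f u v ≡ g u v) → IsEquivalenceᵇ f → IsEquivalenceᵇ g
  IsEquivalenceᵇ-cong f≗g (refl-f , sym-f , trans-f) =
    (λ u → trans (sym (f≗g u u)) (refl-f u)) ,
    (λ u v u∼v → trans (sym (f≗g v u)) (sym-f u v (trans (f≗g u v) u∼v))) ,
    (λ u v w u∼v v∼w → trans (sym (f≗g u w)) (trans-f u v w (trans (f≗g u v) u∼v) (trans (f≗g v w) v∼w)))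

  IsCount-⇔ : ∀ {A : Set} {P Q : A → Set} {j} → (∀ z → P z ⇔ Q z) → IsCount P j → IsCount Q j
  IsCount-⇔ P⇔Q (L , unique , members , length≡) = L , unique ,
    (λ z → mk⇔ (λ z∈L → Equivalence.to (P⇔Q z) (Equivalence.to (members z) z∈L))
               (λ Qz → Equivalence.from (members z) (Equivalence.from (P⇔Q z) Qz))) , length≡

  IsCount-unique : ∀ {A : Set} {P : A → Set} {j j′} → IsCount P j → IsCount P j′ → j ≡ j′
  IsCount-unique (L , L-unique , L-members , refl) (L′ , L′-unique , L′-members , refl) =
    ↭-length (∼bag⇒↭ (unique∧set⇒bag L-unique L′-unique λ {z} →
      mk⇔ (λ z∈L → Equivalence.from (L′-members z) (Equivalence.to (L-members z) z∈L))
          (λ z∈L′ → Equivalence.from (L-members z) (Equivalence.to (L′-members z) z∈L′))))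

  NumBlocksᵇ-cong : ∀ {n} {f g : Vertex n → Vertex n → Bool} {j} → (∀ u v → f u v ≡ g u v) → NumBlocksᵇ f j → NumBlocksᵇ g j
  NumBlocksᵇ-cong {f = f} {g} f≗g = IsCount-⇔ λ B →
    mk⇔ (λ (u , fu≡B) → u , trans (sym (rows≡ u)) fu≡B) (λ (u , gu≡B) → u , trans (rows≡ u) gu≡B)
    where
    rows≡ : ∀ u → toSubset (f u) ≡ toSubset (g u)
    rows≡ u = VSubset-ext (λ v → trans (mem-toSubset (f u) v) (trans (f≗g u v) (sym (mem-toSubset (g u) v))))

  NumBlocksᵇ⇒NumBlocks : ∀ {n} (f : Vertex n → Vertex n → Bool) {j} → NumBlocksᵇ f j → NumBlocks (toRel f) j
  NumBlocksᵇ⇒NumBlocks f = IsCount-⇔ λ B →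
    mk⇔ (λ (u , e) → u , trans (row-toRel f u) e) (λ (u , e) → u , trans (sym (row-toRel f u)) e)

  NumBlocks⇒NumBlocksᵇ : ∀ {n} (R : Rel n) {j} → NumBlocks R j → NumBlocksᵇ ⟦ R ⟧ j
  NumBlocks⇒NumBlocksᵇ R = IsCount-⇔ λ B →
    mk⇔ (λ (u , e) → u , trans (VSubset-ext (mem-toSubset (⟦ R ⟧ u))) e)
        (λ (u , e) → u , trans (sym (VSubset-ext (mem-toSubset (⟦ R ⟧ u)))) e)

  Reach-mono : ∀ {n} {S S′ : Vertex n → Set} {u v} → (∀ w → S w → S′ w) → Reach S u v → Reach S′ u v
  Reach-mono S⊆S′ here = here
  Reach-mono S⊆S′ (step walk edge Sw) = step (Reach-mono S⊆S′ walk) edge (S⊆S′ _ Sw)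

  Reach-++ : ∀ {n} {S : Vertex n → Set} {u v w} → Reach S u v → Reach S v w → Reach S u w
  Reach-++ walk here = walk
  Reach-++ walk (step walk′ edge Sw) = step (Reach-++ walk walk′) edge Sw

  Reach-end : ∀ {n} {S : Vertex n → Set} {u v} → Reach S u v → S u → S v
  Reach-end here Su = Su
  Reach-end (step _ _ Sv) _ = Sv

  BlocksConnectedᵇ-cong : ∀ {n} {f g : Vertex n → Vertex n → Bool} → (∀ u v → f u v ≡ g u v) →
    BlocksConnectedᵇ f → BlocksConnectedᵇ g
  BlocksConnectedᵇ-cong f≗g conn u v u∼v = Reach-mono (λ w fuw → trans (sym (f≗g u w)) fuw) (conn u v (trans (f≗g u v) u∼v))

  IsConnPartitionᵇ-toRel : ∀ {n} {f : Vertex n → Vertex n → Bool} {j} → IsConnPartitionᵇ f j → IsConnPartitionᵇ ⟦ toRel f ⟧ j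
  IsConnPartitionᵇ-toRel {f = f} (equiv , conn , blocks) =
    IsEquivalenceᵇ-cong f≗ equiv , BlocksConnectedᵇ-cong f≗ conn , NumBlocksᵇ-cong f≗ blocks
    where
    f≗ : ∀ u v → f u v ≡ ⟦ toRel f ⟧ u v
    f≗ u v = sym (⟦toRel⟧ f u v)

  shiftV : ∀ {n} → Vertex n → Vertex (suc n)
  shiftV (r , c) = (r , suc c)

  Adj-shiftV : ∀ {n} {u v : Vertex n} → Adj u v → Adj (shiftV u) (shiftV v)
  Adj-shiftV (inj₁ (r≡ , inj₁ c→c′)) = inj₁ (r≡ , inj₁ (cong suc c→c′))
  Adj-shiftV (inj₁ (r≡ , inj₂ c′→c)) = inj₁ (r≡ , inj₂ (cong suc c′→c))
  Adj-shiftV (inj₂ (c≡ , r≢)) = inj₂ (cong suc c≡ , r≢)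

  Reach-shiftV : ∀ {n} {S′ : Vertex n → Set} {S : Vertex (suc n) → Set} {u v} →
    (∀ w → S′ w → S (shiftV w)) → Reach S′ u v → Reach S (shiftV u) (shiftV v)
  Reach-shiftV S′⇒S here = here
  Reach-shiftV S′⇒S (step walk edge Sw) = step (Reach-shiftV S′⇒S walk) (Adj-shiftV edge) (S′⇒S _ Sw)

  Adj-unshiftV : ∀ {n} {r r′ : Fin 2} {c c′ : Fin n} → Adj {suc n} (r , suc c) (r′ , suc c′) → Adj (r , c) (r′ , c′)
  Adj-unshiftV (inj₁ (r≡ , inj₁ c→c′)) = inj₁ (r≡ , inj₁ (ℕₚ.suc-injective c→c′))
  Adj-unshiftV (inj₁ (r≡ , inj₂ c′→c)) = inj₁ (r≡ , inj₂ (ℕₚ.suc-injective c′→c))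
  Adj-unshiftV (inj₂ (c≡ , r≢)) = inj₂ (Finₚ.suc-injective c≡ , r≢)

  Adj-leaving-column0 : ∀ {n} {r r′ : Fin 2} {c : Fin (suc n)} → Adj {suc (suc n)} (r , zero) (r′ , suc c) → r ≡ r′ × c ≡ zero
  Adj-leaving-column0 (inj₁ (r≡ , inj₁ 1≡c)) = r≡ , Finₚ.toℕ-injective (sym (ℕₚ.suc-injective 1≡c))
  Adj-leaving-column0 (inj₁ (_ , inj₂ ()))
  Adj-leaving-column0 (inj₂ (() , _))

  Adj-entering-column0 : ∀ {n} {r r′ : Fin 2} {c : Fin (suc n)} → Adj {suc (suc n)} (r , suc c) (r′ , zero) → r ≡ r′ × c ≡ zero
  Adj-entering-column0 (inj₁ (_ , inj₁ ()))
  Adj-entering-column0 (inj₁ (r≡ , inj₂ 1≡c)) = r≡ , Finₚ.toℕ-injective (sym (ℕₚ.suc-injective 1≡c))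
  Adj-entering-column0 (inj₂ (() , _))

  Reach-leaves-column0 : ∀ {n} {S : Vertex (suc (suc n)) → Set} {r r′ c} → S (r , zero) → Reach S (r , zero) (r′ , suc c) →
    Σ (Fin 2) λ r″ → S (r″ , zero) × S (r″ , suc zero)
  Reach-leaves-column0 Su (step {v = (_ , suc _)} walk edge Sw) = Reach-leaves-column0 Su walk
  Reach-leaves-column0 Su (step {v = (r″ , zero)} walk edge Sw) with Adj-leaving-column0 edge
  ... | refl , refl = r″ , Reach-end walk Su , Sw

  sameTag : Fin 2 → Fin 2 → Bool
  sameTag zero zero = true
  sameTag zero (suc zero) = false
  sameTag (suc zero) zero = false
  sameTag (suc zero) (suc zero) = true

  sameTag-refl : ∀ i → sameTag i i ≡ true
  sameTag-refl zero = refl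
  sameTag-refl (suc zero) = refl

  sameTag⇒≡ : ∀ i j → sameTag i j ≡ true → i ≡ j
  sameTag⇒≡ zero zero _ = refl
  sameTag⇒≡ (suc zero) (suc zero) _ = refl
  sameTag⇒≡ zero (suc zero) ()
  sameTag⇒≡ (suc zero) zero ()

  freshTags : Bool → Bool → Bool → List (Fin 2)
  freshTags false false false = zero ∷ suc zero ∷ []
  freshTags false false true = zero ∷ []
  freshTags false true false = suc zero ∷ []
  freshTags true false false = zero ∷ []
  freshTags _ _ _ = []

  -- Prepending a column to a partition of the ladder with m + 1 columns.  The new cells are x (top) and
  -- y (bottom); the old first column is p, q, or p′, q′ after the shift.  The flags say whether the
  -- partition joins a: x and y, b: x and p′, c: y and q′.  Each new cell is anchored either to an old
  -- cell, whose block it joins, or to one of two fresh tags.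
  module Extension (m : ℕ) where

    Old New : Set
    Old = Vertex (suc m)
    New = Vertex (suc (suc m))

    Anchor : Set
    Anchor = Old ⊎ Fin 2

    p q : Old
    p = (zero , zero)
    q = (suc zero , zero)

    x y p′ q′ : New
    x = (zero , zero)
    y = (suc zero , zero)
    p′ = (zero , suc zero)
    q′ = (suc zero , suc zero)

    anchorRel : (Old → Old → Bool) → Anchor → Anchor → Bool
    anchorRel f (inj₁ u) (inj₁ v) = f u v
    anchorRel f (inj₁ u) (inj₂ j) = false
    anchorRel f (inj₂ i) (inj₁ v) = false
    anchorRel f (inj₂ i) (inj₂ j) = sameTag i j

    anchorX : Bool → Bool → Bool → Anchor
    anchorX a true c = inj₁ p
    anchorX true false true = inj₁ q
    anchorX true false false = inj₂ zero
    anchorX false false c = inj₂ zero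

    anchorY : Bool → Bool → Bool → Anchor
    anchorY a b true = inj₁ q
    anchorY true true false = inj₁ p
    anchorY true false false = inj₂ zero
    anchorY false b false = inj₂ (suc zero)

    anchor : Bool → Bool → Bool → New → Anchor
    anchor a b c (r , suc k) = inj₁ (r , k)
    anchor a b c (zero , zero) = anchorX a b c
    anchor a b c (suc zero , zero) = anchorY a b c

    extend : (Old → Old → Bool) → Bool → Bool → Bool → New → New → Bool
    extend f a b c u v = anchorRel f (anchor a b c u) (anchor a b c v)

    anchorRel-isEquivalence : ∀ {f} → IsEquivalenceᵇ f → IsEquivalenceᵇ (anchorRel f)
    anchorRel-isEquivalence {f} (refl-f , sym-f , trans-f) = reflexive , symmetric , transitive
      where
      reflexive : ∀ u → anchorRel f u u ≡ true
      reflexive (inj₁ u) = refl-f u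
      reflexive (inj₂ i) = sameTag-refl i
      symmetric : ∀ u v → anchorRel f u v ≡ true → anchorRel f v u ≡ true
      symmetric (inj₁ u) (inj₁ v) u∼v = sym-f u v u∼v
      symmetric (inj₂ i) (inj₂ j) i∼j with sameTag⇒≡ i j i∼j
      ... | refl = i∼j
      transitive : ∀ u v w → anchorRel f u v ≡ true → anchorRel f v w ≡ true → anchorRel f u w ≡ true
      transitive (inj₁ u) (inj₁ v) (inj₁ w) u∼v v∼w = trans-f u v w u∼v v∼w
      transitive (inj₂ i) (inj₂ j) (inj₂ k) i∼j j∼k with sameTag⇒≡ i j i∼j
      ... | refl = j∼k

    extend-isEquivalence : ∀ {f} a b c → IsEquivalenceᵇ f → IsEquivalenceᵇ (extend f a b c)
    extend-isEquivalence a b c eq with anchorRel-isEquivalence eq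
    ... | refl-A , sym-A , trans-A =
      (λ u → refl-A (anchor a b c u)) ,
      (λ u v → sym-A (anchor a b c u) (anchor a b c v)) ,
      (λ u v w → trans-A (anchor a b c u) (anchor a b c v) (anchor a b c w))

    x—p′ : Adj x p′
    x—p′ = inj₁ (refl , inj₁ refl)
    p′—x : Adj p′ x
    p′—x = inj₁ (refl , inj₂ refl)
    y—q′ : Adj y q′
    y—q′ = inj₁ (refl , inj₁ refl)
    q′—y : Adj q′ y
    q′—y = inj₁ (refl , inj₂ refl)
    x—y : Adj x y
    x—y = inj₂ (refl , λ ())
    y—x : Adj y x
    y—x = inj₂ (refl , λ ())

    Reach-to-anchor : ∀ {S : New → Set} a b c w o → anchor a b c w ≡ inj₁ o →
      (∀ w′ → anchor a b c w′ ≡ inj₁ o → S w′) → Reach S w (shiftV o)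
    Reach-to-anchor a b c (r , suc k) o refl S⊇ = here
    Reach-to-anchor a true c (zero , zero) o refl S⊇ = step here x—p′ (S⊇ p′ refl)
    Reach-to-anchor true false true (zero , zero) o refl S⊇ = step (step here x—y (S⊇ y refl)) y—q′ (S⊇ q′ refl)
    Reach-to-anchor a b true (suc zero , zero) o refl S⊇ = step here y—q′ (S⊇ q′ refl)
    Reach-to-anchor true true false (suc zero , zero) o refl S⊇ = step (step here y—x (S⊇ x refl)) x—p′ (S⊇ p′ refl)

    Reach-from-anchor : ∀ {S : New → Set} a b c w o → anchor a b c w ≡ inj₁ o →
      (∀ w′ → anchor a b c w′ ≡ inj₁ o → S w′) → Reach S (shiftV o) w
    Reach-from-anchor a b c (r , suc k) o refl S⊇ = here
    Reach-from-anchor a true c (zero , zero) o refl S⊇ = step here p′—x (S⊇ x refl)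
    Reach-from-anchor true false true (zero , zero) o refl S⊇ = step (step here q′—y (S⊇ y refl)) y—x (S⊇ x refl)
    Reach-from-anchor a b true (suc zero , zero) o refl S⊇ = step here q′—y (S⊇ y refl)
    Reach-from-anchor true true false (suc zero , zero) o refl S⊇ = step (step here p′—x (S⊇ x refl)) x—y (S⊇ y refl)

    Reach-between-fresh : ∀ {S : New → Set} a b c u v t t′ → anchor a b c u ≡ inj₂ t → anchor a b c v ≡ inj₂ t′ →
      S v → Reach S u v
    Reach-between-fresh a b c (zero , zero) (zero , zero) t t′ _ _ Sv = here
    Reach-between-fresh a b c (zero , zero) (suc zero , zero) t t′ _ _ Sv = step here x—y Sv
    Reach-between-fresh a b c (suc zero , zero) (zero , zero) t t′ _ _ Sv = step here y—x Sv
    Reach-between-fresh a b c (suc zero , zero) (suc zero , zero) t t′ _ _ Sv = here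

    extend-connected : ∀ {f} a b c → IsEquivalenceᵇ f → BlocksConnectedᵇ f → BlocksConnectedᵇ (extend f a b c)
    extend-connected {f} a b c (refl-f , _ , _) conn u v u∼v = go (anchor a b c u) (anchor a b c v) refl refl u∼v
      where
      S : New → Set
      S w = anchorRel f (anchor a b c u) (anchor a b c w) ≡ true
      go : ∀ α β → anchor a b c u ≡ α → anchor a b c v ≡ β → anchorRel f α β ≡ true → Reach S u v
      go (inj₁ o) (inj₁ o′) α≡ β≡ o∼o′ =
        Reach-++ (Reach-to-anchor a b c u o α≡ (λ w′ e → subst₂ S-anchors (sym α≡) (sym e) (refl-f o)))
        (Reach-++ (Reach-shiftV (λ w s → subst (λ α → anchorRel f α (inj₁ w) ≡ true) (sym α≡) s) (conn o o′ o∼o′))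
                  (Reach-from-anchor a b c v o′ β≡ (λ w′ e → subst₂ S-anchors (sym α≡) (sym e) o∼o′)))
        where
        S-anchors : Anchor → Anchor → Set
        S-anchors α β = anchorRel f α β ≡ true
      go (inj₂ t) (inj₂ t′) α≡ β≡ t∼t′ =
        Reach-between-fresh a b c u v t t′ α≡ β≡ (subst₂ (λ α β → anchorRel f α β ≡ true) (sym α≡) (sym β≡) t∼t′)

    tagged : Fin 2 → Anchor → Bool
    tagged t (inj₁ _) = false
    tagged t (inj₂ j) = sameTag t j

    oldIn : VSubset (suc m) → Anchor → Bool
    oldIn B (inj₁ v) = mem B v
    oldIn B (inj₂ _) = false

    extendBlock : Bool → Bool → Bool → VSubset (suc m) → VSubset (suc (suc m))
    extendBlock a b c B = toSubset (λ w → oldIn B (anchor a b c w))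

    freshBlock : Bool → Bool → Bool → Fin 2 → VSubset (suc (suc m))
    freshBlock a b c t = toSubset (λ w → tagged t (anchor a b c w))

    freshTags-sound : ∀ a b c t → t ∈ freshTags a b c → ∃ λ w → anchor a b c w ≡ inj₂ t
    freshTags-sound false false false t (here refl) = x , refl
    freshTags-sound false false false t (there (here refl)) = y , refl
    freshTags-sound false false true t (here refl) = x , refl
    freshTags-sound false true false t (here refl) = y , refl
    freshTags-sound true false false t (here refl) = x , refl

    freshTags-complete : ∀ a b c w t → anchor a b c w ≡ inj₂ t → t ∈ freshTags a b c
    freshTags-complete false false false (zero , zero) t refl = here refl
    freshTags-complete false false true (zero , zero) t refl = here refl
    freshTags-complete true false false (zero , zero) t refl = here refl
    freshTags-complete false false false (suc zero , zero) t refl = there (here refl)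
    freshTags-complete false true false (suc zero , zero) t refl = here refl
    freshTags-complete true false false (suc zero , zero) t refl = here refl
    freshTags-complete a b true (suc zero , zero) t ()
    freshTags-complete true true false (suc zero , zero) t ()

    freshBlocks-unique : ∀ a b c → Unique (map (freshBlock a b c) (freshTags a b c))
    freshBlocks-unique false false false = (blocks≢ ∷ []) ∷ [] ∷ []
      where
      blocks≢ : freshBlock false false false zero ≢ freshBlock false false false (suc zero)
      blocks≢ e with trans (sym (mem-toSubset (λ w → tagged zero (anchor false false false w)) x))
                     (trans (cong (λ B → mem B x) e) (mem-toSubset (λ w → tagged (suc zero) (anchor false false false w)) x))
      ... | ()
    freshBlocks-unique false false true = [] ∷ []
    freshBlocks-unique false true false = [] ∷ []
    freshBlocks-unique false true true = []
    freshBlocks-unique true false false = [] ∷ []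
    freshBlocks-unique true false true = []
    freshBlocks-unique true true false = []
    freshBlocks-unique true true true = []

    blockOf : (Old → Old → Bool) → Bool → Bool → Bool → Anchor → VSubset (suc (suc m))
    blockOf f a b c (inj₁ v) = extendBlock a b c (toSubset (f v))
    blockOf f a b c (inj₂ t) = freshBlock a b c t

    row-extend : ∀ f a b c w → toSubset (extend f a b c w) ≡ blockOf f a b c (anchor a b c w)
    row-extend f a b c w = go (anchor a b c w) refl
      where
      go : ∀ α → anchor a b c w ≡ α → toSubset (extend f a b c w) ≡ blockOf f a b c α
      go (inj₁ v) e = VSubset-ext λ w′ → begin
        mem (toSubset (extend f a b c w)) w′      ≡⟨ mem-toSubset (extend f a b c w) w′ ⟩
        anchorRel f (anchor a b c w) (anchor a b c w′) ≡⟨ cong (λ α → anchorRel f α (anchor a b c w′)) e ⟩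
        anchorRel f (inj₁ v) (anchor a b c w′)    ≡⟨ old-row (anchor a b c w′) ⟩
        oldIn (toSubset (f v)) (anchor a b c w′)   ≡⟨ mem-toSubset (λ w″ → oldIn (toSubset (f v)) (anchor a b c w″)) w′ ⟨
        mem (extendBlock a b c (toSubset (f v))) w′ ∎
        where
        open ≡-Reasoning
        old-row : ∀ β → anchorRel f (inj₁ v) β ≡ oldIn (toSubset (f v)) β
        old-row (inj₁ z) = sym (mem-toSubset (f v) z)
        old-row (inj₂ j) = refl
      go (inj₂ t) e = VSubset-ext λ w′ → begin
        mem (toSubset (extend f a b c w)) w′      ≡⟨ mem-toSubset (extend f a b c w) w′ ⟩
        anchorRel f (anchor a b c w) (anchor a b c w′) ≡⟨ cong (λ α → anchorRel f α (anchor a b c w′)) e ⟩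
        anchorRel f (inj₂ t) (anchor a b c w′)    ≡⟨ fresh-row (anchor a b c w′) ⟩
        tagged t (anchor a b c w′)                ≡⟨ mem-toSubset (λ w″ → tagged t (anchor a b c w″)) w′ ⟨
        mem (freshBlock a b c t) w′               ∎
        where
        open ≡-Reasoning
        fresh-row : ∀ β → anchorRel f (inj₂ t) β ≡ tagged t β
        fresh-row (inj₁ z) = refl
        fresh-row (inj₂ j) = refl

    mem-extendBlock-shiftV : ∀ a b c B v → mem (extendBlock a b c B) (shiftV v) ≡ mem B v
    mem-extendBlock-shiftV a b c B v = mem-toSubset (λ w → oldIn B (anchor a b c w)) (shiftV v)

    mem-freshBlock-shiftV : ∀ a b c t v → mem (freshBlock a b c t) (shiftV v) ≡ false
    mem-freshBlock-shiftV a b c t v = mem-toSubset (λ w → tagged t (anchor a b c w)) (shiftV v)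

    extend-numBlocks : ∀ f a b c j → IsEquivalenceᵇ f → NumBlocksᵇ f j →
      NumBlocksᵇ (extend f a b c) (j + length (freshTags a b c))
    extend-numBlocks f a b c j (refl-f , _ , _) (L , L-unique , L-blocks , L-length) =
      L′ , Uniqueₚ.++⁺ (Uniqueₚ.map⁺ extendBlock-injective L-unique) (freshBlocks-unique a b c) old≢fresh ,
      (λ B → mk⇔ (⇒block B) (block⇒ B)) ,
      trans (Listₚ.length-++ (map (extendBlock a b c) L))
        (cong₂ _+_ (trans (Listₚ.length-map (extendBlock a b c) L) L-length) (Listₚ.length-map (freshBlock a b c) (freshTags a b c)))
      where
      L′ : List (VSubset (suc (suc m)))
      L′ = map (extendBlock a b c) L ++ map (freshBlock a b c) (freshTags a b c)
      extendBlock-injective : ∀ {B B′} → extendBlock a b c B ≡ extendBlock a b c B′ → B ≡ B′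
      extendBlock-injective {B} {B′} e = VSubset-ext λ v → trans (sym (mem-extendBlock-shiftV a b c B v))
        (trans (cong (λ B → mem B (shiftV v)) e) (mem-extendBlock-shiftV a b c B′ v))
      -- Old blocks meet the old columns, fresh blocks do not.
      old≢fresh : ∀ {B} → ¬ (B ∈ map (extendBlock a b c) L × B ∈ map (freshBlock a b c) (freshTags a b c))
      old≢fresh (B∈old , B∈fresh) with ∈-map⁻ (extendBlock a b c) B∈old | ∈-map⁻ (freshBlock a b c) B∈fresh
      ... | B′ , B′∈L , refl | t , _ , e with Equivalence.to (L-blocks B′) B′∈L
      ... | v , refl with trans (sym (trans (mem-extendBlock-shiftV a b c (toSubset (f v)) v) (trans (mem-toSubset (f v) v) (refl-f v))))
                                (trans (cong (λ B → mem B (shiftV v)) e) (mem-freshBlock-shiftV a b c t v))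
      ... | ()
      ⇒block : ∀ B → B ∈ L′ → ∃ λ w → toSubset (extend f a b c w) ≡ B
      ⇒block B B∈ with ∈-++⁻ (map (extendBlock a b c) L) B∈
      ... | inj₁ B∈old with ∈-map⁻ (extendBlock a b c) B∈old
      ... | B′ , B′∈L , refl with Equivalence.to (L-blocks B′) B′∈L
      ... | v , refl = shiftV v , row-extend f a b c (shiftV v)
      ⇒block B B∈ | inj₂ B∈fresh with ∈-map⁻ (freshBlock a b c) B∈fresh
      ... | t , t∈ , refl with freshTags-sound a b c t t∈
      ... | w , e = w , trans (row-extend f a b c w) (cong (blockOf f a b c) e)
      block⇒ : ∀ B → (∃ λ w → toSubset (extend f a b c w) ≡ B) → B ∈ L′
      block⇒ B (w , refl) = go (anchor a b c w) refl
        where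
        go : ∀ α → anchor a b c w ≡ α → toSubset (extend f a b c w) ∈ L′
        go (inj₁ v) e = subst (_∈ L′) (sym (trans (row-extend f a b c w) (cong (blockOf f a b c) e)))
          (∈-++⁺ˡ (∈-map⁺ (extendBlock a b c) (Equivalence.from (L-blocks (toSubset (f v))) (v , refl))))
        go (inj₂ t) e = subst (_∈ L′) (sym (trans (row-extend f a b c w) (cong (blockOf f a b c) e)))
          (∈-++⁺ʳ (map (extendBlock a b c) L) (∈-map⁺ (freshBlock a b c) (freshTags-complete a b c w t e)))

  -- On the 4-cycle x, y, q′, p′ an equivalence relation never relates exactly three of the four consecutive pairs.
  cycleConsistent : Bool → Bool → Bool → Bool → Bool
  cycleConsistent true true true false = false
  cycleConsistent true true false true = false
  cycleConsistent true false true true = false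
  cycleConsistent false true true true = false
  cycleConsistent _ _ _ _ = true

  module Restriction (m : ℕ) (R : Rel (suc (suc m))) (R-equiv : IsEquivalenceᵇ ⟦ R ⟧) (R-conn : BlocksConnectedᵇ ⟦ R ⟧) where
    open Extension m

    refl-R : ∀ u → ⟦ R ⟧ u u ≡ true
    refl-R = proj₁ R-equiv
    sym-R : ∀ u v → ⟦ R ⟧ u v ≡ true → ⟦ R ⟧ v u ≡ true
    sym-R = proj₁ (proj₂ R-equiv)
    trans-R : ∀ u v w → ⟦ R ⟧ u v ≡ true → ⟦ R ⟧ v w ≡ true → ⟦ R ⟧ u w ≡ true
    trans-R = proj₂ (proj₂ R-equiv)

    restriction : Old → Old → Bool
    restriction u v = ⟦ R ⟧ (shiftV u) (shiftV v)

    restriction-isEquivalence : IsEquivalenceᵇ restriction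
    restriction-isEquivalence = (λ u → refl-R (shiftV u)) , (λ u v → sym-R (shiftV u) (shiftV v)) ,
                                (λ u v w → trans-R (shiftV u) (shiftV v) (shiftV w))

    Shortened : Old → New → Set
    Shortened u (r , zero) =
      Σ (Fin 2) λ r′ → ⟦ R ⟧ (shiftV u) (r′ , suc zero) ≡ true × Reach (λ z → restriction u z ≡ true) u (r′ , zero)
    Shortened u (r , suc k) = Reach (λ z → restriction u z ≡ true) u (r , k)

    -- A walk that detours through the new column leaves and re-enters it at column 1, whose two cells are adjacent.
    shorten : ∀ u t → Reach (λ w → ⟦ R ⟧ (shiftV u) w ≡ true) (shiftV u) t → Shortened u t
    shorten u t here = here
    shorten u (_ , suc _) (step {v = (r , suc k)} walk edge Sw) = step (shorten u (r , suc k) walk) (Adj-unshiftV edge) Sw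
    shorten u (_ , zero) (step {v = (r , suc k)} walk edge Sw) with Adj-entering-column0 edge
    ... | refl , refl = r , Reach-end walk (refl-R (shiftV u)) , shorten u (r , suc zero) walk
    shorten u (_ , zero) (step {v = (r , zero)} walk edge Sw) = shorten u (r , zero) walk
    shorten u (_ , suc _) (step {v = (r , zero)} walk edge Sw) with Adj-leaving-column0 edge | shorten u (r , zero) walk
    ... | refl , refl | r′ , _ , walk′ with r′ Fin.≟ r
    ... | yes refl = walk′
    ... | no r′≢r = step walk′ (inj₂ (refl , r′≢r)) Sw

    restriction-connected : BlocksConnectedᵇ restriction
    restriction-connected u v u∼v = shorten u (shiftV v) (R-conn (shiftV u) (shiftV v) u∼v)

    s₀ a₀ b₀ c₀ : Bool
    s₀ = ⟦ R ⟧ p′ q′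
    a₀ = ⟦ R ⟧ x y
    b₀ = ⟦ R ⟧ x p′
    c₀ = ⟦ R ⟧ y q′

    private
      false≢true : false ≢ true
      false≢true ()

    cycleConsistent-holds : ∀ s a b c → ⟦ R ⟧ p′ q′ ≡ s → ⟦ R ⟧ x y ≡ a → ⟦ R ⟧ x p′ ≡ b → ⟦ R ⟧ y q′ ≡ c →
      cycleConsistent s a b c ≡ true
    cycleConsistent-holds true true true false s≡ a≡ b≡ c≡ =
      ⊥-elim (false≢true (trans (sym c≡) (trans-R y x q′ (sym-R x y a≡) (trans-R x p′ q′ b≡ s≡))))
    cycleConsistent-holds true true false true s≡ a≡ b≡ c≡ =
      ⊥-elim (false≢true (trans (sym b≡) (trans-R x y p′ a≡ (trans-R y q′ p′ c≡ (sym-R p′ q′ s≡)))))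
    cycleConsistent-holds true false true true s≡ a≡ b≡ c≡ =
      ⊥-elim (false≢true (trans (sym a≡) (trans-R x p′ y b≡ (trans-R p′ q′ y s≡ (sym-R y q′ c≡)))))
    cycleConsistent-holds false true true true s≡ a≡ b≡ c≡ =
      ⊥-elim (false≢true (trans (sym s≡) (trans-R p′ x q′ (sym-R x p′ b≡) (trans-R x y q′ a≡ c≡))))
    cycleConsistent-holds true true true true _ _ _ _ = refl
    cycleConsistent-holds true true false false _ _ _ _ = refl
    cycleConsistent-holds true false true false _ _ _ _ = refl
    cycleConsistent-holds true false false true _ _ _ _ = refl
    cycleConsistent-holds true false false false _ _ _ _ = refl
    cycleConsistent-holds false true true false _ _ _ _ = refl
    cycleConsistent-holds false true false true _ _ _ _ = refl
    cycleConsistent-holds false true false false _ _ _ _ = refl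
    cycleConsistent-holds false false true true _ _ _ _ = refl
    cycleConsistent-holds false false true false _ _ _ _ = refl
    cycleConsistent-holds false false false true _ _ _ _ = refl
    cycleConsistent-holds false false false false _ _ _ _ = refl

    consistent₀ : cycleConsistent s₀ a₀ b₀ c₀ ≡ true
    consistent₀ = cycleConsistent-holds s₀ a₀ b₀ c₀ refl refl refl refl

    -- If the new cell x were joined to an old cell, its block would contain a horizontal edge (r, 0) — (r, 1).
    x-row : ∀ a b c → ⟦ R ⟧ x y ≡ a → ⟦ R ⟧ x p′ ≡ b → ⟦ R ⟧ y q′ ≡ c →
      ∀ t → ⟦ R ⟧ x (shiftV t) ≡ anchorRel restriction (anchorX a b c) (inj₁ t)
    x-row a true c a≡ b≡ c≡ t = sameRowᵇ R-equiv x p′ (shiftV t) b≡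
    x-row true false true a≡ b≡ c≡ t = sameRowᵇ R-equiv x q′ (shiftV t) (trans-R x y q′ a≡ c≡)
    x-row true false false a≡ b≡ c≡ t = ¬-not λ x∼t → crossing (Reach-leaves-column0 (refl-R x) (R-conn x (shiftV t) x∼t))
      where
      crossing : ¬ (Σ (Fin 2) λ r → ⟦ R ⟧ x (r , zero) ≡ true × ⟦ R ⟧ x (r , suc zero) ≡ true)
      crossing (zero , _ , x∼p′) = false≢true (trans (sym b≡) x∼p′)
      crossing (suc zero , _ , x∼q′) = false≢true (trans (sym c≡) (trans-R y x q′ (sym-R x y a≡) x∼q′))
    x-row false false c a≡ b≡ c≡ t = ¬-not λ x∼t → crossing (Reach-leaves-column0 (refl-R x) (R-conn x (shiftV t) x∼t))
      where
      crossing : ¬ (Σ (Fin 2) λ r → ⟦ R ⟧ x (r , zero) ≡ true × ⟦ R ⟧ x (r , suc zero) ≡ true)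
      crossing (zero , _ , x∼p′) = false≢true (trans (sym b≡) x∼p′)
      crossing (suc zero , x∼y , _) = false≢true (trans (sym a≡) x∼y)

    y-row : ∀ a b c → ⟦ R ⟧ x y ≡ a → ⟦ R ⟧ x p′ ≡ b → ⟦ R ⟧ y q′ ≡ c →
      ∀ t → ⟦ R ⟧ y (shiftV t) ≡ anchorRel restriction (anchorY a b c) (inj₁ t)
    y-row a b true a≡ b≡ c≡ t = sameRowᵇ R-equiv y q′ (shiftV t) c≡
    y-row true true false a≡ b≡ c≡ t = sameRowᵇ R-equiv y p′ (shiftV t) (trans-R y x p′ (sym-R x y a≡) b≡)
    y-row true false false a≡ b≡ c≡ t = ¬-not λ y∼t → crossing (Reach-leaves-column0 (refl-R y) (R-conn y (shiftV t) y∼t))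
      where
      crossing : ¬ (Σ (Fin 2) λ r → ⟦ R ⟧ y (r , zero) ≡ true × ⟦ R ⟧ y (r , suc zero) ≡ true)
      crossing (suc zero , _ , y∼q′) = false≢true (trans (sym c≡) y∼q′)
      crossing (zero , _ , y∼p′) = false≢true (trans (sym b≡) (trans-R x y p′ a≡ y∼p′))
    y-row false b false a≡ b≡ c≡ t = ¬-not λ y∼t → crossing (Reach-leaves-column0 (refl-R y) (R-conn y (shiftV t) y∼t))
      where
      crossing : ¬ (Σ (Fin 2) λ r → ⟦ R ⟧ y (r , zero) ≡ true × ⟦ R ⟧ y (r , suc zero) ≡ true)
      crossing (suc zero , _ , y∼q′) = false≢true (trans (sym c≡) y∼q′)
      crossing (zero , y∼x , _) = false≢true (trans (sym a≡) (sym-R y x y∼x))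

    x-y : ∀ s a b c → ⟦ R ⟧ p′ q′ ≡ s → ⟦ R ⟧ x y ≡ a → ⟦ R ⟧ x p′ ≡ b → ⟦ R ⟧ y q′ ≡ c →
      cycleConsistent s a b c ≡ true →
      ⟦ R ⟧ x y ≡ anchorRel restriction (anchorX a b c) (anchorY a b c)
    x-y true true true false _ _ _ _ ()
    x-y true true false true _ _ _ _ ()
    x-y true false true true _ _ _ _ ()
    x-y false true true true _ _ _ _ ()
    x-y true true true true s≡ a≡ b≡ c≡ _ = trans a≡ (sym s≡)
    x-y false false true true s≡ a≡ b≡ c≡ _ = trans a≡ (sym s≡)
    x-y false true true false s≡ a≡ b≡ c≡ _ = trans a≡ (sym (refl-R p′))
    x-y false true false true s≡ a≡ b≡ c≡ _ = trans a≡ (sym (refl-R q′))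
    x-y s true false false _ a≡ _ _ _ = a≡
    x-y s false false false _ a≡ _ _ _ = a≡
    x-y s false true false _ a≡ _ _ _ = a≡
    x-y s false false true _ a≡ _ _ _ = a≡

    R≡extend : ∀ s a b c → ⟦ R ⟧ p′ q′ ≡ s → ⟦ R ⟧ x y ≡ a → ⟦ R ⟧ x p′ ≡ b → ⟦ R ⟧ y q′ ≡ c →
      cycleConsistent s a b c ≡ true →
      ∀ u v → ⟦ R ⟧ u v ≡ extend restriction a b c u v
    R≡extend s a b c s≡ a≡ b≡ c≡ ok = go
      where
      ext-equiv : IsEquivalenceᵇ (extend restriction a b c)
      ext-equiv = extend-isEquivalence a b c restriction-isEquivalence
      go : ∀ u v → ⟦ R ⟧ u v ≡ extend restriction a b c u v
      go (r , suc k) (r′ , suc k′) = refl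
      go (zero , zero) (r , suc k) = x-row a b c a≡ b≡ c≡ (r , k)
      go (suc zero , zero) (r , suc k) = y-row a b c a≡ b≡ c≡ (r , k)
      go (r , suc k) (zero , zero) =
        trans (symᵇ R-equiv (r , suc k) x) (trans (x-row a b c a≡ b≡ c≡ (r , k)) (symᵇ ext-equiv x (r , suc k)))
      go (r , suc k) (suc zero , zero) =
        trans (symᵇ R-equiv (r , suc k) y) (trans (y-row a b c a≡ b≡ c≡ (r , k)) (symᵇ ext-equiv y (r , suc k)))
      go (zero , zero) (zero , zero) = trans (refl-R x) (sym (proj₁ ext-equiv x))
      go (suc zero , zero) (suc zero , zero) = trans (refl-R y) (sym (proj₁ ext-equiv y))
      go (zero , zero) (suc zero , zero) = x-y s a b c s≡ a≡ b≡ c≡ ok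
      go (suc zero , zero) (zero , zero) =
        trans (symᵇ R-equiv y x) (trans (x-y s a b c s≡ a≡ b≡ c≡ ok) (symᵇ ext-equiv x y))

    R≡extend-restriction : R ≡ toRel (extend restriction a₀ b₀ c₀)
    R≡extend-restriction = Rel-ext λ u v →
      trans (R≡extend s₀ a₀ b₀ c₀ refl refl refl refl consistent₀ u v) (sym (⟦toRel⟧ (extend restriction a₀ b₀ c₀) u v))

  record Transition : Set where
    constructor transition
    field
      s a b c : Bool
      δ : ℕ

  -- For each state a of the new first column, the consistent flag combinations; δ = 2 − |freshTags a b c|
  -- is the increase of the deficit 2 · columns − blocks.
  transitions : Bool → List Transition
  transitions false = transition true false false false 0 ∷ transition true false true false 1 ∷ transition true false false true 1 ∷
                      transition false false false false 0 ∷ transition false false true false 1 ∷ transition false false false true 1 ∷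
                      transition false false true true 2 ∷ []
  transitions true = transition true true false false 1 ∷ transition true true true true 2 ∷ transition false true false false 1 ∷
                     transition false true true false 2 ∷ transition false true false true 2 ∷ []

  transition-exists : ∀ s a b c → cycleConsistent s a b c ≡ true → ∃ λ δ → transition s a b c δ ∈ transitions a
  transition-exists true true true true _ = 2 , there (here refl)
  transition-exists true true false false _ = 1 , here refl
  transition-exists true false true false _ = 1 , there (here refl)
  transition-exists true false false true _ = 1 , there (there (here refl))
  transition-exists true false false false _ = 0 , here refl
  transition-exists false true true false _ = 2 , there (there (there (here refl)))
  transition-exists false true false true _ = 2 , there (there (there (there (here refl))))
  transition-exists false true false false _ = 1 , there (there (here refl))
  transition-exists false false true true _ = 2 , there (there (there (there (there (there (here refl))))))
  transition-exists false false true false _ = 1 , there (there (there (there (here refl))))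
  transition-exists false false false true _ = 1 , there (there (there (there (there (here refl)))))
  transition-exists false false false false _ = 0 , there (there (there (here refl)))

  module _ (m : ℕ) where
    open Extension m

    extend-flags : ∀ f s a b c → IsEquivalenceᵇ f → f p q ≡ s → cycleConsistent s a b c ≡ true →
      anchorRel f (anchorX a b c) (anchorY a b c) ≡ a ×
      anchorRel f (anchorX a b c) (inj₁ p) ≡ b × anchorRel f (anchorY a b c) (inj₁ q) ≡ c
    extend-flags f true true true true (refl-f , _) p∼q _ = p∼q , refl-f p , refl-f q
    extend-flags f true true false false _ _ _ = refl , refl , refl
    extend-flags f true false true false (refl-f , _) _ _ = refl , refl-f p , refl
    extend-flags f true false false true (refl-f , _) _ _ = refl , refl , refl-f q
    extend-flags f true false false false _ _ _ = refl , refl , refl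
    extend-flags f false true true false (refl-f , _) p≁q _ = refl-f p , refl-f p , p≁q
    extend-flags f false true false true eq@(refl-f , _) p≁q _ = refl-f q , trans (symᵇ eq q p) p≁q , refl-f q
    extend-flags f false true false false _ _ _ = refl , refl , refl
    extend-flags f false false true true (refl-f , _) p≁q _ = p≁q , refl-f p , refl-f q
    extend-flags f false false true false (refl-f , _) _ _ = refl , refl-f p , refl
    extend-flags f false false false true (refl-f , _) _ _ = refl , refl , refl-f q
    extend-flags f false false false false _ _ _ = refl , refl , refl

    extend-isConnPartition : ∀ {f j} a b c → IsConnPartitionᵇ f j →
      IsConnPartitionᵇ (extend f a b c) (j + length (freshTags a b c))
    extend-isConnPartition {f} {j} a b c (equiv , conn , blocks) =
      extend-isEquivalence a b c equiv , extend-connected a b c equiv conn , extend-numBlocks f a b c j equiv blocks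

  extendRel : ∀ {m} → Bool → Bool → Bool → Rel (suc m) → Rel (suc (suc m))
  extendRel {m} a b c R = toRel (Extension.extend m ⟦ R ⟧ a b c)

  shiftList : ∀ {A : Set} → ℕ → (ℕ → List A) → ℕ → List A
  shiftList zero g e = g e
  shiftList (suc d) g zero = []
  shiftList (suc d) g (suc e) = shiftList d g e

  oneColumn : Bool → Vertex 1 → Vertex 1 → Bool
  oneColumn a (zero , _) (zero , _) = true
  oneColumn a (zero , _) (suc zero , _) = a
  oneColumn a (suc zero , _) (zero , _) = a
  oneColumn a (suc zero , _) (suc zero , _) = true

  -- partitions m e s lists the connected partitions of the ladder with m + 1 columns, 2 (m + 1) − e blocks,
  -- and first column joined iff s.
  mutual
    partitions : (m : ℕ) → ℕ → Bool → List (Rel (suc m))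
    partitions zero zero false = toRel (oneColumn false) ∷ []
    partitions zero (suc zero) true = toRel (oneColumn true) ∷ []
    partitions zero zero true = []
    partitions zero (suc zero) false = []
    partitions zero (suc (suc e)) s = []
    partitions (suc m) e s = partitionsVia m e (transitions s)

    partitionsVia : (m : ℕ) → ℕ → List Transition → List (Rel (suc (suc m)))
    partitionsVia m e [] = []
    partitionsVia m e (t ∷ ts) = partitionsBy m e t ++ partitionsVia m e ts

    partitionsBy : (m : ℕ) → ℕ → Transition → List (Rel (suc (suc m)))
    partitionsBy m e (transition s a b c δ) = map (extendRel a b c) (shiftList δ (λ e′ → partitions m e′ s) e)

  partitionsVia-∈⁻ : ∀ m e ts {R} → R ∈ partitionsVia m e ts → ∃ λ t → t ∈ ts × R ∈ partitionsBy m e t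
  partitionsVia-∈⁻ m e (t ∷ ts) R∈ with ∈-++⁻ (partitionsBy m e t) R∈
  ... | inj₁ R∈t = t , here refl , R∈t
  ... | inj₂ R∈ts with partitionsVia-∈⁻ m e ts R∈ts
  ... | t′ , t′∈ , R∈t′ = t′ , there t′∈ , R∈t′

  partitionsVia-∈⁺ : ∀ m e ts {R t} → t ∈ ts → R ∈ partitionsBy m e t → R ∈ partitionsVia m e ts
  partitionsVia-∈⁺ m e (t ∷ ts) (here refl) R∈ = ∈-++⁺ˡ R∈
  partitionsVia-∈⁺ m e (t ∷ ts) (there t∈) R∈ = ∈-++⁺ʳ (partitionsBy m e t) (partitionsVia-∈⁺ m e ts t∈ R∈)

  shiftList-∈⁻ : ∀ {A : Set} d (g : ℕ → List A) e {z} → z ∈ shiftList d g e → ∃ λ e′ → e ≡ d + e′ × z ∈ g e′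
  shiftList-∈⁻ zero g e z∈ = e , refl , z∈
  shiftList-∈⁻ (suc d) g (suc e) z∈ with shiftList-∈⁻ d g e z∈
  ... | e′ , refl , z∈′ = e′ , refl , z∈′

  shiftList-∈⁺ : ∀ {A : Set} d (g : ℕ → List A) e′ {z} → z ∈ g e′ → z ∈ shiftList d g (d + e′)
  shiftList-∈⁺ zero g e′ z∈ = z∈
  shiftList-∈⁺ (suc d) g e′ z∈ = shiftList-∈⁺ d g e′ z∈

  shiftList-unique : ∀ {A : Set} d (g : ℕ → List A) → (∀ e → Unique (g e)) → ∀ e → Unique (shiftList d g e)
  shiftList-unique zero g unique e = unique e
  shiftList-unique (suc d) g unique zero = []
  shiftList-unique (suc d) g unique (suc e) = shiftList-unique d g unique e

  x₁ y₁ : Vertex 1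
  x₁ = (zero , zero)
  y₁ = (suc zero , zero)

  oneColumn-isEquivalence : ∀ a → IsEquivalenceᵇ (oneColumn a)
  oneColumn-isEquivalence a = reflexive , symmetric , transitive
    where
    reflexive : ∀ u → oneColumn a u u ≡ true
    reflexive (zero , zero) = refl
    reflexive (suc zero , zero) = refl
    symmetric : ∀ u v → oneColumn a u v ≡ true → oneColumn a v u ≡ true
    symmetric (zero , zero) (zero , zero) u∼v = u∼v
    symmetric (zero , zero) (suc zero , zero) u∼v = u∼v
    symmetric (suc zero , zero) (zero , zero) u∼v = u∼v
    symmetric (suc zero , zero) (suc zero , zero) u∼v = u∼v
    transitive : ∀ u v w → oneColumn a u v ≡ true → oneColumn a v w ≡ true → oneColumn a u w ≡ true
    transitive (zero , zero) (zero , zero) w _ v∼w = v∼w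
    transitive (suc zero , zero) (suc zero , zero) w _ v∼w = v∼w
    transitive (zero , zero) (suc zero , zero) (zero , zero) _ _ = refl
    transitive (zero , zero) (suc zero , zero) (suc zero , zero) u∼v _ = u∼v
    transitive (suc zero , zero) (zero , zero) (zero , zero) u∼v _ = u∼v
    transitive (suc zero , zero) (zero , zero) (suc zero , zero) _ _ = refl

  oneColumn-connected : ∀ a → BlocksConnectedᵇ (oneColumn a)
  oneColumn-connected a (zero , zero) (zero , zero) _ = here
  oneColumn-connected a (suc zero , zero) (suc zero , zero) _ = here
  oneColumn-connected a (zero , zero) (suc zero , zero) u∼v = step here (inj₂ (refl , λ ())) u∼v
  oneColumn-connected a (suc zero , zero) (zero , zero) u∼v = step here (inj₂ (refl , λ ())) u∼v

  oneColumn-numBlocks-true : NumBlocksᵇ (oneColumn true) 1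
  oneColumn-numBlocks-true = (toSubset (oneColumn true x₁) ∷ []) , ([] ∷ []) , (λ B → mk⇔ ⇒block block⇒) , refl
    where
    ⇒block : ∀ {B} → B ∈ (toSubset (oneColumn true x₁) ∷ []) → ∃ λ u → toSubset (oneColumn true u) ≡ B
    ⇒block (here refl) = x₁ , refl
    rows≡ : ∀ u v → oneColumn true u v ≡ oneColumn true x₁ v
    rows≡ (zero , zero) v = refl
    rows≡ (suc zero , zero) (zero , zero) = refl
    rows≡ (suc zero , zero) (suc zero , zero) = refl
    block⇒ : ∀ {B} → (∃ λ u → toSubset (oneColumn true u) ≡ B) → B ∈ (toSubset (oneColumn true x₁) ∷ [])
    block⇒ (u , refl) = here (VSubset-ext λ v → trans (mem-toSubset (oneColumn true u) v)
                                                (trans (rows≡ u v) (sym (mem-toSubset (oneColumn true x₁) v))))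

  oneColumn-numBlocks-false : NumBlocksᵇ (oneColumn false) 2
  oneColumn-numBlocks-false = (toSubset (oneColumn false x₁) ∷ toSubset (oneColumn false y₁) ∷ []) ,
    ((blocks≢ ∷ []) ∷ [] ∷ []) , (λ B → mk⇔ ⇒block block⇒) , refl
    where
    blocks≢ : toSubset (oneColumn false x₁) ≢ toSubset (oneColumn false y₁)
    blocks≢ e with trans (sym (mem-toSubset (oneColumn false x₁) x₁)) (trans (cong (λ B → mem B x₁) e) (mem-toSubset (oneColumn false y₁) x₁))
    ... | ()
    ⇒block : ∀ {B} → B ∈ (toSubset (oneColumn false x₁) ∷ toSubset (oneColumn false y₁) ∷ []) → ∃ λ u → toSubset (oneColumn false u) ≡ B
    ⇒block (here refl) = x₁ , refl
    ⇒block (there (here refl)) = y₁ , refl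
    block⇒ : ∀ {B} → (∃ λ u → toSubset (oneColumn false u) ≡ B) → B ∈ (toSubset (oneColumn false x₁) ∷ toSubset (oneColumn false y₁) ∷ [])
    block⇒ ((zero , zero) , refl) = here refl
    block⇒ ((suc zero , zero) , refl) = there (here refl)

  cells : ℕ → ℕ
  cells m = 2 * suc m

  joined₀ : ∀ {n} → Rel (suc n) → Bool
  joined₀ R = ⟦ R ⟧ (zero , zero) (suc zero , zero)

  Valid : (m : ℕ) → ℕ → Bool → Rel (suc m) → Set
  Valid m e s R = IsConnPartitionᵇ ⟦ R ⟧ (cells m ∸ e) × e < cells m × joined₀ R ≡ s

  TransitionFacts : Bool → Transition → Set
  TransitionFacts a′ (transition s a b c δ) = a ≡ a′ × cycleConsistent s a b c ≡ true × length (freshTags a b c) + δ ≡ 2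

  transitions-facts : ∀ a → All (TransitionFacts a) (transitions a)
  transitions-facts false = (refl , refl , refl) ∷ (refl , refl , refl) ∷ (refl , refl , refl) ∷ (refl , refl , refl) ∷
                            (refl , refl , refl) ∷ (refl , refl , refl) ∷ (refl , refl , refl) ∷ []
  transitions-facts true = (refl , refl , refl) ∷ (refl , refl , refl) ∷ (refl , refl , refl) ∷ (refl , refl , refl) ∷
                           (refl , refl , refl) ∷ []

  blocks-after-step : ∀ m e len δ → e < cells m → len + δ ≡ 2 → (cells m ∸ e) + len ≡ cells (suc m) ∸ (δ + e)
  blocks-after-step m e len δ e< len+δ≡2 = trans (by-cases len δ len+δ≡2) (cong (_∸ (δ + e)) (sym (ℕₚ.*-suc 2 (suc m))))
    where
    by-cases : ∀ len δ → len + δ ≡ 2 → (cells m ∸ e) + len ≡ (2 + cells m) ∸ (δ + e)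
    by-cases 2 0 refl = trans (ℕₚ.+-comm (cells m ∸ e) 2) (sym (ℕₚ.+-∸-assoc 2 (ℕₚ.<⇒≤ e<)))
    by-cases 1 1 refl = trans (ℕₚ.+-comm (cells m ∸ e) 1) (sym (ℕₚ.+-∸-assoc 1 (ℕₚ.<⇒≤ e<)))
    by-cases 0 2 refl = ℕₚ.+-identityʳ (cells m ∸ e)

  deficit-after-step : ∀ m e len δ → e < cells m → len + δ ≡ 2 → δ + e < cells (suc m)
  deficit-after-step m e len δ e< len+δ≡2 = subst (δ + e <_) (sym (ℕₚ.*-suc 2 (suc m)))
    (ℕₚ.+-mono-≤-< (subst (δ ≤_) len+δ≡2 (ℕₚ.m≤n+m δ len)) e<)

  partitions-valid : ∀ m e s R → R ∈ partitions m e s → Valid m e s R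
  partitions-valid zero zero false R (here refl) =
    IsConnPartitionᵇ-toRel (oneColumn-isEquivalence false , oneColumn-connected false , oneColumn-numBlocks-false) ,
    s≤s z≤n , ⟦toRel⟧ (oneColumn false) x₁ y₁
  partitions-valid zero (suc zero) true R (here refl) =
    IsConnPartitionᵇ-toRel (oneColumn-isEquivalence true , oneColumn-connected true , oneColumn-numBlocks-true) ,
    s≤s (s≤s z≤n) , ⟦toRel⟧ (oneColumn true) x₁ y₁
  partitions-valid (suc m) e s R R∈ with partitionsVia-∈⁻ m e (transitions s) R∈
  ... | t@(transition s′ a b c δ) , t∈ , R∈t with ∈-map⁻ (extendRel a b c) R∈t | All.lookup (transitions-facts s) t∈
  ... | R′ , R′∈ , refl | refl , consistent , len+δ≡2 with shiftList-∈⁻ δ (λ e′ → partitions m e′ s′) e R′∈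
  ... | e′ , refl , R′∈′ with partitions-valid m e′ s′ R′ R′∈′
  ... | R′-part@(R′-equiv , _) , e′< , joined≡ =
    IsConnPartitionᵇ-toRel (subst (IsConnPartitionᵇ f) (blocks-after-step m e′ _ δ e′< len+δ≡2) (extend-isConnPartition m a b c R′-part)) ,
    deficit-after-step m e′ _ δ e′< len+δ≡2 ,
    trans (⟦toRel⟧ f (zero , zero) (suc zero , zero)) (proj₁ (extend-flags m ⟦ R′ ⟧ s′ a b c R′-equiv joined≡ consistent))
    where
    f : Vertex (suc (suc m)) → Vertex (suc (suc m)) → Bool
    f = Extension.extend m ⟦ R′ ⟧ a b c

  Flags : Set
  Flags = Bool × Bool × Bool × Bool

  flags : Transition → Flags
  flags (transition s a b c δ) = s , a , b , c

  flagsOf : ∀ {m} → Rel (suc (suc m)) → Flags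
  flagsOf R = ⟦ R ⟧ (zero , suc zero) (suc zero , suc zero) , ⟦ R ⟧ (zero , zero) (suc zero , zero) ,
              ⟦ R ⟧ (zero , zero) (zero , suc zero) , ⟦ R ⟧ (suc zero , zero) (suc zero , suc zero)

  transitions-flags-unique : ∀ a → Unique (map flags (transitions a))
  transitions-flags-unique false =
    ((λ ()) ∷ (λ ()) ∷ (λ ()) ∷ (λ ()) ∷ (λ ()) ∷ (λ ()) ∷ []) ∷ ((λ ()) ∷ (λ ()) ∷ (λ ()) ∷ (λ ()) ∷ (λ ()) ∷ []) ∷
    ((λ ()) ∷ (λ ()) ∷ (λ ()) ∷ (λ ()) ∷ []) ∷ ((λ ()) ∷ (λ ()) ∷ (λ ()) ∷ []) ∷ ((λ ()) ∷ (λ ()) ∷ []) ∷ ((λ ()) ∷ []) ∷ [] ∷ []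
  transitions-flags-unique true =
    ((λ ()) ∷ (λ ()) ∷ (λ ()) ∷ (λ ()) ∷ []) ∷ ((λ ()) ∷ (λ ()) ∷ (λ ()) ∷ []) ∷ ((λ ()) ∷ (λ ()) ∷ []) ∷ ((λ ()) ∷ []) ∷ [] ∷ []

  partitionsBy-flags : ∀ m e a t → t ∈ transitions a → ∀ R → R ∈ partitionsBy m e t → flagsOf R ≡ flags t
  partitionsBy-flags m e a t@(transition s a′ b c δ) t∈ R R∈ with ∈-map⁻ (extendRel a′ b c) R∈ | All.lookup (transitions-facts a) t∈
  ... | R′ , R′∈ , refl | _ , consistent , _ with shiftList-∈⁻ δ (λ e′ → partitions m e′ s) e R′∈
  ... | e′ , refl , R′∈′ with partitions-valid m e′ s R′ R′∈′
  ... | (R′-equiv , _) , _ , joined≡ with extend-flags m ⟦ R′ ⟧ s a′ b c R′-equiv joined≡ consistent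
  ... | x∼y , x∼p′ , y∼q′ =
    cong₂ _,_ (trans (⟦toRel⟧ f (zero , suc zero) (suc zero , suc zero)) joined≡)
    (cong₂ _,_ (trans (⟦toRel⟧ f (zero , zero) (suc zero , zero)) x∼y)
    (cong₂ _,_ (trans (⟦toRel⟧ f (zero , zero) (zero , suc zero)) x∼p′) (trans (⟦toRel⟧ f (suc zero , zero) (suc zero , suc zero)) y∼q′)))
    where
    f : Vertex (suc (suc m)) → Vertex (suc (suc m)) → Bool
    f = Extension.extend m ⟦ R′ ⟧ a′ b c

  extendRel-injective : ∀ {m} a b c {R R′ : Rel (suc m)} → extendRel a b c R ≡ extendRel a b c R′ → R ≡ R′
  extendRel-injective {m} a b c {R} {R′} e = Rel-ext λ u v →
    trans (sym (⟦toRel⟧ (Extension.extend m ⟦ R ⟧ a b c) (shiftV u) (shiftV v)))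
    (trans (cong (λ R → ⟦ R ⟧ (shiftV u) (shiftV v)) e) (⟦toRel⟧ (Extension.extend m ⟦ R′ ⟧ a b c) (shiftV u) (shiftV v)))

  -- Partitions produced by different transitions differ in their flags, hence are distinct.
  partitions-unique : ∀ m e s → Unique (partitions m e s)
  partitions-unique zero zero false = [] ∷ []
  partitions-unique zero (suc zero) true = [] ∷ []
  partitions-unique zero zero true = []
  partitions-unique zero (suc zero) false = []
  partitions-unique zero (suc (suc e)) s = []
  partitions-unique (suc m) e s = go (transitions s) (λ t∈ → t∈) (transitions-flags-unique s)
    where
    partitionsBy-unique : ∀ t → Unique (partitionsBy m e t)
    partitionsBy-unique (transition s′ a b c δ) =
      Uniqueₚ.map⁺ (extendRel-injective a b c) (shiftList-unique δ (λ e′ → partitions m e′ s′) (λ e′ → partitions-unique m e′ s′) e)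
    go : ∀ ts → (∀ {t} → t ∈ ts → t ∈ transitions s) → Unique (map flags ts) → Unique (partitionsVia m e ts)
    go [] _ _ = []
    go (t ∷ ts) ts⊆ (t∉ ∷ ts-unique) = Uniqueₚ.++⁺ (partitionsBy-unique t) (go ts (λ t∈ → ts⊆ (there t∈)) ts-unique) disjoint
      where
      disjoint : ∀ {R} → ¬ (R ∈ partitionsBy m e t × R ∈ partitionsVia m e ts)
      disjoint {R} (R∈t , R∈ts) with partitionsVia-∈⁻ m e ts R∈ts
      ... | t′ , t′∈ , R∈t′ = All.lookup t∉ (∈-map⁺ flags t′∈)
        (trans (sym (partitionsBy-flags m e s t (ts⊆ (here refl)) R R∈t)) (partitionsBy-flags m e s t′ (ts⊆ (there t′∈)) R R∈t′))

  anchorRel-cong : ∀ {m} {f g : Vertex (suc m) → Vertex (suc m) → Bool} → (∀ u v → f u v ≡ g u v) →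
    ∀ α β → Extension.anchorRel m f α β ≡ Extension.anchorRel m g α β
  anchorRel-cong f≗g (inj₁ u) (inj₁ v) = f≗g u v
  anchorRel-cong f≗g (inj₁ u) (inj₂ j) = refl
  anchorRel-cong f≗g (inj₂ i) (inj₁ v) = refl
  anchorRel-cong f≗g (inj₂ i) (inj₂ j) = refl

  partitions-complete : ∀ m (R : Rel (suc m)) → IsEquivalenceᵇ ⟦ R ⟧ → BlocksConnectedᵇ ⟦ R ⟧ →
    ∃ λ e → R ∈ partitions m e (joined₀ R)
  partitions-complete zero R R-equiv _ = go (joined₀ R) refl
    where
    R≗oneColumn : ∀ a → joined₀ R ≡ a → ∀ u v → ⟦ R ⟧ u v ≡ ⟦ toRel (oneColumn a) ⟧ u v
    R≗oneColumn a joined≡ u v = trans (by-cases u v) (sym (⟦toRel⟧ (oneColumn a) u v))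
      where
      by-cases : ∀ u v → ⟦ R ⟧ u v ≡ oneColumn a u v
      by-cases (zero , zero) (zero , zero) = proj₁ R-equiv x₁
      by-cases (suc zero , zero) (suc zero , zero) = proj₁ R-equiv y₁
      by-cases (zero , zero) (suc zero , zero) = joined≡
      by-cases (suc zero , zero) (zero , zero) = trans (symᵇ R-equiv y₁ x₁) joined≡
    go : ∀ a → joined₀ R ≡ a → ∃ λ e → R ∈ partitions zero e (joined₀ R)
    go true joined≡ = 1 , subst (λ s → R ∈ partitions zero 1 s) (sym joined≡) (here (Rel-ext (R≗oneColumn true joined≡)))
    go false joined≡ = 0 , subst (λ s → R ∈ partitions zero 0 s) (sym joined≡) (here (Rel-ext (R≗oneColumn false joined≡)))
  partitions-complete (suc m) R R-equiv R-conn =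
    δ + e′ , partitionsVia-∈⁺ m (δ + e′) (transitions a₀) t∈
      (subst (_∈ partitionsBy m (δ + e′) (transition s₀ a₀ b₀ c₀ δ)) (sym R≡)
        (∈-map⁺ (extendRel a₀ b₀ c₀) (shiftList-∈⁺ δ (λ e″ → partitions m e″ s₀) e′ (subst (λ s → R₀ ∈ partitions m e′ s) joined≡ R₀∈))))
    where
    open Restriction m R R-equiv R-conn
    R₀ : Rel (suc m)
    R₀ = toRel restriction
    restriction≗ : ∀ u v → restriction u v ≡ ⟦ R₀ ⟧ u v
    restriction≗ u v = sym (⟦toRel⟧ restriction u v)
    IH : ∃ λ e → R₀ ∈ partitions m e (joined₀ R₀)
    IH = partitions-complete m R₀ (IsEquivalenceᵇ-cong restriction≗ restriction-isEquivalence)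
                                  (BlocksConnectedᵇ-cong restriction≗ restriction-connected)
    e′ : ℕ
    e′ = proj₁ IH
    R₀∈ : R₀ ∈ partitions m e′ (joined₀ R₀)
    R₀∈ = proj₂ IH
    joined≡ : joined₀ R₀ ≡ s₀
    joined≡ = ⟦toRel⟧ restriction (zero , zero) (suc zero , zero)
    δ : ℕ
    δ = proj₁ (transition-exists s₀ a₀ b₀ c₀ consistent₀)
    t∈ : transition s₀ a₀ b₀ c₀ δ ∈ transitions a₀
    t∈ = proj₂ (transition-exists s₀ a₀ b₀ c₀ consistent₀)
    R≡ : R ≡ extendRel a₀ b₀ c₀ R₀
    R≡ = trans R≡extend-restriction (Rel-ext λ u v → begin
      ⟦ toRel (Extension.extend m restriction a₀ b₀ c₀) ⟧ u v
        ≡⟨ ⟦toRel⟧ (Extension.extend m restriction a₀ b₀ c₀) u v ⟩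
      Extension.extend m restriction a₀ b₀ c₀ u v
        ≡⟨ anchorRel-cong restriction≗ (Extension.anchor m a₀ b₀ c₀ u) (Extension.anchor m a₀ b₀ c₀ v) ⟩
      Extension.extend m ⟦ R₀ ⟧ a₀ b₀ c₀ u v
        ≡⟨ ⟦toRel⟧ (Extension.extend m ⟦ R₀ ⟧ a₀ b₀ c₀) u v ⟨
      ⟦ extendRel a₀ b₀ c₀ R₀ ⟧ u v ∎)
      where open ≡-Reasoning

  #partitions : ℕ → ℕ → Bool → ℕ
  #partitions m e s = length (partitions m e s)

  partitions-count : ∀ m k → r≡ (cells m ∸ k) (suc m) (#partitions m k true + #partitions m k false)
  partitions-count m k = L , Uniqueₚ.++⁺ (partitions-unique m k true) (partitions-unique m k false) disjoint ,
                         (λ R → mk⇔ (⇒partition R) (partition⇒ R)) , Listₚ.length-++ (partitions m k true)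
    where
    L : List (Rel (suc m))
    L = partitions m k true ++ partitions m k false
    disjoint : ∀ {R} → ¬ (R ∈ partitions m k true × R ∈ partitions m k false)
    disjoint {R} (R∈true , R∈false) with partitions-valid m k true R R∈true | partitions-valid m k false R R∈false
    ... | _ , _ , joined≡true | _ , _ , joined≡false with trans (sym joined≡true) joined≡false
    ... | ()
    valid⇒ : ∀ {s} R → R ∈ partitions m k s → IsConnPartition (cells m ∸ k) R
    valid⇒ {s} R R∈ with partitions-valid m k s R R∈
    ... | (equiv , conn , blocks) , _ =
      equiv , conn , subst (λ R′ → NumBlocks R′ (cells m ∸ k)) (toRel-⟦⟧ R) (NumBlocksᵇ⇒NumBlocks ⟦ R ⟧ blocks)
    ⇒partition : ∀ R → R ∈ L → IsConnPartition (cells m ∸ k) R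
    ⇒partition R R∈ = [ valid⇒ R , valid⇒ R ]′ (∈-++⁻ (partitions m k true) R∈)
    partition⇒ : ∀ R → IsConnPartition (cells m ∸ k) R → R ∈ L
    partition⇒ R (equiv , conn , blocks) with partitions-complete m R equiv conn
    ... | e , R∈ with partitions-valid m e _ R R∈
    ... | (_ , _ , blocks′) , e< , _ = place (joined₀ R) (subst (λ e → R ∈ partitions m e _) e≡k R∈)
      where
      blocks≡ : cells m ∸ e ≡ cells m ∸ k
      blocks≡ = IsCount-unique blocks′ (NumBlocks⇒NumBlocksᵇ R blocks)
      k< : k < cells m
      k< = ℕₚ.m∸n≢0⇒n<m λ cells∸k≡0 → ℕₚ.m<n⇒n≢0 (ℕₚ.m<n⇒0<n∸m e<) (trans blocks≡ cells∸k≡0)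
      e≡k : e ≡ k
      e≡k = ℕₚ.∸-cancelˡ-≡ (ℕₚ.<⇒≤ e<) (ℕₚ.<⇒≤ k<) blocks≡
      place : ∀ s → R ∈ partitions m k s → R ∈ L
      place true R∈′ = ∈-++⁺ˡ R∈′
      place false R∈′ = ∈-++⁺ʳ (partitions m k true) R∈′

  lagⁿ : ℕ → (ℕ → ℕ) → ℕ → ℕ
  lagⁿ zero g = g
  lagⁿ (suc d) g = lag (lagⁿ d g)

  length-shiftList : ∀ {A : Set} d (g : ℕ → List A) e → length (shiftList d g e) ≡ lagⁿ d (λ e′ → length (g e′)) e
  length-shiftList zero g e = refl
  length-shiftList (suc d) g zero = refl
  length-shiftList (suc d) g (suc e) = length-shiftList d g e

  #partitionsBy : ℕ → ℕ → Transition → ℕ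
  #partitionsBy m e (transition s a b c δ) = lagⁿ δ (λ e′ → #partitions m e′ s) e

  length-partitionsVia : ∀ m e ts → length (partitionsVia m e ts) ≡ sum (map (#partitionsBy m e) ts)
  length-partitionsVia m e [] = refl
  length-partitionsVia m e (t@(transition s a b c δ) ∷ ts) = begin
    length (partitionsBy m e t ++ partitionsVia m e ts)           ≡⟨ Listₚ.length-++ (partitionsBy m e t) ⟩
    length (partitionsBy m e t) + length (partitionsVia m e ts)   ≡⟨ cong₂ _+_ length-t (length-partitionsVia m e ts) ⟩
    #partitionsBy m e t + sum (map (#partitionsBy m e) ts) ∎
    where
    open ≡-Reasoning
    length-t : length (partitionsBy m e t) ≡ #partitionsBy m e t
    length-t = trans (Listₚ.length-map (extendRel a b c) (shiftList δ (λ e′ → partitions m e′ s) e))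
                     (length-shiftList δ (λ e′ → partitions m e′ s) e)

  module _ (m k : ℕ) where
    open ℕ-Solver.+-*-Solver
    private
      T D : ℕ → ℕ
      T e = #partitions m e true
      D e = #partitions m e false

    #partitions-true-step : #partitions (suc m) k true ≡ lag T k + lag (lag T) k + lag D k + 2 * lag (lag D) k
    #partitions-true-step = trans (length-partitionsVia m k (transitions true))
      (solve 4 (λ t t″ d d″ → t :+ (t″ :+ (d :+ (d″ :+ (d″ :+ con 0)))) := t :+ t″ :+ d :+ con 2 :* d″) refl
        (lag T k) (lag (lag T) k) (lag D k) (lag (lag D) k))

    #partitions-false-step : #partitions (suc m) k false ≡ T k + 2 * lag T k + D k + 2 * lag D k + lag (lag D) k
    #partitions-false-step = trans (length-partitionsVia m k (transitions false))
      (solve 5 (λ t t′ d d′ d″ → t :+ (t′ :+ (t′ :+ (d :+ (d′ :+ (d′ :+ (d″ :+ con 0))))))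
                               := t :+ con 2 :* t′ :+ d :+ con 2 :* d′ :+ d″) refl
        (T k) (lag T k) (D k) (lag D k) (lag (lag D) k))

open import Data.Nat using (ℕ; zero; suc; _+_; _*_; _∸_; _≥_; _^_; s≤s)
open import Data.Nat.Properties using (m≤n⇒m≤1+n)
open import Data.Bool using (true; false)
open import Data.Vec using (Vec)
open import Data.Rational using (ℚ)
open import Data.Product using (Σ; ∃; _×_; _,_)
open import Relation.Binary.PropositionalEquality using (_≡_; refl; trans; sym)
open import Defs
open Polynomials using (EvPoly; EvPoly-unshift; EvPoly⇒polynomial; lead≡3^k*1/k!)
open LinearRecurrence using (total-EvPoly)
open LadderPartitions using (#partitions; partitions-count; #partitions-true-step; #partitions-false-step)

-- ladderCount k n = r_{2n−k}(n) for n ≥ 1; the value at n = 0 is a dummy.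
ladderCount : ℕ → ℕ → ℕ
ladderCount k zero = 0
ladderCount k (suc m) = #partitions m k true + #partitions m k false

ladderCount-EvPoly : ∀ k → EvPoly k (ℕ→ℚ (3 ^ k)) (ladderCount k)
ladderCount-EvPoly k = EvPoly-unshift (total-EvPoly (λ m e → #partitions m e true) (λ m e → #partitions m e false)
  refl refl #partitions-true-step #partitions-false-step k)

theorem3 : (k : ℕ) →
    Σ (Vec ℚ (suc k)) λ P →
      leadCoeff P ≡ lead k ×
      (∃ λ N → ∀ n → n ≥ N →
        ∃ λ m → r≡ (2 * n ∸ k) n m × ℕ→ℚ m ≡ evalPoly P (ℕ→ℚ n))
theorem3 k =
  let P , lead-P , N , agrees = EvPoly⇒polynomial (ladderCount-EvPoly k)
  in P , trans lead-P (sym (lead≡3^k*1/k! k)) , suc N , λ where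
       (suc m) (s≤s N≤m) → ladderCount k (suc m) , partitions-count m k , agrees (suc m) (m≤n⇒m≤1+n N≤m)
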